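{- Let $m,q\geq 3$, let $\zeta$ be a polarity of $\mathrm{PG}(m-1,q)$, and let $x^\ast$ be a point not contained in the hyperplane $H^\ast:=(x^\ast)^\zeta$. Let $\Gamma$ be the graph with vertex set $\mathrm{PG}(m-1,q)\setminus(H^\ast\cup\{x^\ast\})$ (the points not in $H^\ast$ and different from $x^\ast$), in which two (possibly equal) vertices $x,y$ are adjacent whenever $y\in x^\zeta$. Then $\Gamma$ is an LDDG with parameters $$\left(q^{m-1}-1,\ q^{m-2},\ 0,\ q^{m-3},\ \frac{q^{m-1}-1}{q-1},\ q-1\right).$$
   Context: $\mathrm{PG}(m-1,q)$ is the projective space of $\mathbb{F}_q^m$: points are 1-dimensional subspaces, and a projective subspace of dimension $i$ is the set of points in an $(i+1)$-dimensional vector subspace; hyperplanes have dimension $m-2$. A polarity $\zeta$ is an inclusion-reversing bijection of the set of subspaces with $\zeta^2=\mathrm{id}$; for a point $x$, $x^\zeta$ is a hyperplane and $x\in y^\zeta$ iff $y\in x^\zeta$. Graphs here are finite, undirected, without multiple edges, but loops are allowed: a vertex may be adjacent to itself. For a vertex $x$, $\Gamma(x)$ is the set of vertices adjacent to $x$ (containing $x$ iff $x$ has a loop), and the degree of $x$ is $|\Gamma(x)|$ (a loop contributes exactly 1). Common neighbours of $x,y$ are the elements of $\Gamma(x)\cap\Gamma(y)$. A $k$-regular graph on $v$ vertices is an LDDG with parameters $(v,k,\lambda_1,\lambda_2,M,n)$ if its vertex set can be partitioned into $M$ classes of size $n$ such that any two distinct vertices of the same class have exactly $\lambda_1$ common neighbours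 and any two vertices of different classes have exactly $\lambda_2$ common neighbours. -}

module Defs where

open import Level using (Level; _⊔_) renaming (suc to lsuc; zero to 0ℓ)
open import Data.Nat using (ℕ; zero; suc; _∸_; _/_)
open import Data.Fin using (Fin)
open import Data.Vec using (Vec; map; zipWith; replicate)
open import Data.Product using (Σ; ∃; ∃-syntax; _×_; proj₁)
open import Relation.Binary.PropositionalEquality using (_≡_; _≢_)
open import Relation.Binary.Core using (Rel)
open import Relation.Nullary using (¬_)
open import Algebra.Structures using (IsCommutativeRing)

-- Finite cardinality of a type up to an equivalence relation:
-- |A / ≈| = n  iff there is an injective (mod ≈), surjective (mod ≈)
-- enumeration Fin n → A.

HasSize : ∀ {a ℓ} (A : Set a) (_≈_ : Rel A ℓ) → ℕ → Set (a ⊔ ℓ)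
HasSize A _≈_ n =
  Σ (Fin n → A) λ f →
    (∀ i j → f i ≈ f j → i ≡ j) × (∀ x → ∃[ i ] (f i ≈ x))

SubsetSize : ∀ {a ℓ p} (A : Set a) (_≈_ : Rel A ℓ) (P : A → Set p) → ℕ → Set (a ⊔ ℓ ⊔ p)
SubsetSize A _≈_ P n = HasSize (Σ A P) (λ x y → proj₁ x ≈ proj₁ y) n

-- Graphs with loops: vertex type V (with equality ≈) and adjacency Adj.
-- Γ(x) = {y | Adj x y}.  LDDG with parameters (v,k,λ1,λ2,M,n).

record IsLDDG {a ℓ r} (V : Set a) (_≈_ : Rel V ℓ) (Adj : Rel V r)
              (v k λ₁ λ₂ M n : ℕ) : Set (a ⊔ ℓ ⊔ r) where
  field
    vertices  : HasSize V _≈_ v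
    regular   : ∀ x → SubsetSize V _≈_ (Adj x) k
    cls       : V → Fin M
    cls-resp  : ∀ x y → x ≈ y → cls x ≡ cls y
    cls-size  : ∀ c → SubsetSize V _≈_ (λ x → cls x ≡ c) n
    same-cls  : ∀ x y → ¬ (x ≈ y) → cls x ≡ cls y →
                SubsetSize V _≈_ (λ z → Adj x z × Adj y z) λ₁
    diff-cls  : ∀ x y → cls x ≢ cls y →
                SubsetSize V _≈_ (λ z → Adj x z × Adj y z) λ₂

record Field : Set₁ where
  infixl 7 _*_
  infixl 6 _+_
  field
    Carrier : Set
    _+_ _*_ : Carrier → Carrier → Carrier
    -_      : Carrier → Carrier
    0# 1#   : Carrier
    isCommutativeRing : IsCommutativeRing _≡_ _+_ _*_ -_ 0# 1#
    0≢1     : 0# ≢ 1#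
    inverse : ∀ x → x ≢ 0# → ∃[ y ] (x * y ≡ 1#)

module Geometry (F : Field) (m : ℕ) where
  open Field F

  Vect : Set
  Vect = Vec Carrier m

  𝟎 : Vect
  𝟎 = replicate m 0#

  _⊕_ : Vect → Vect → Vect
  _⊕_ = zipWith _+_

  _·_ : Carrier → Vect → Vect
  c · v = map (c *_) v

  -- a (vector) subspace of F^m, i.e. a projective subspace of PG(m-1,F)
  record Subspace : Set₁ where
    field
      _∋_    : Vect → Set
      ∋-𝟎    : _∋_ 𝟎
      ∋-⊕    : ∀ {u v} → _∋_ u → _∋_ v → _∋_ (u ⊕ v)
      ∋-·    : ∀ c {v} → _∋_ v → _∋_ (c · v)
  open Subspace public

  _⊆_ : Subspace → Subspace → Set
  S ⊆ T = ∀ v → S ∋ v → T ∋ v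

  _≐_ : Subspace → Subspace → Set
  S ≐ T = S ⊆ T × T ⊆ S

  -- projective points: 1-dimensional subspaces
  IsPoint : Subspace → Set
  IsPoint P = ∃[ v ] (v ≢ 𝟎 × (∀ w → (P ∋ w → ∃[ c ] (w ≡ c · v))
                                   × (∃[ c ] (w ≡ c · v) → P ∋ w)))

  -- polarity: inclusion-reversing involution on the set of subspaces
  -- (an involution is automatically a bijection)
  record IsPolarity (ζ : Subspace → Subspace) : Set₁ where
    field
      reverses  : ∀ S T → S ⊆ T → ζ T ⊆ ζ S
      involutive : ∀ S → ζ (ζ S) ≐ S

  Point : Set₁
  Point = Σ Subspace IsPoint

  module CorGraph (ζ : Subspace → Subspace) (x* : Subspace) where
    Vertex : Set₁
    Vertex = Σ Point λ P → ¬ (proj₁ P ⊆ ζ x*) × ¬ (proj₁ P ≐ x*)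

    _≈V_ : Vertex → Vertex → Set
    x ≈V y = proj₁ (proj₁ x) ≐ proj₁ (proj₁ y)

    Adj : Vertex → Vertex → Set
    Adj x y = proj₁ (proj₁ y) ⊆ ζ (proj₁ (proj₁ x))

-- natural-number quotient a / d (d = 0 never occurs below since q ≥ 3)
_div_ : ℕ → ℕ → ℕ
a div zero    = 0
a div (suc d) = a / suc d

-- Let v* span x* and H = x*^ζ = ⟨v*⟩^ζ. As v* ∉ H, every vector splits uniquely as u = π u + κ u · v*
-- with π u ∈ H, and for a vertex x both π x ≠ 0 and κ x ≠ 0. The class of x is the point ⟨π x⟩ of H: there
-- are (q^(m-1) - 1)/(q - 1) of them, and the class of ⟨h⟩ consists of the q - 1 points ⟨h + a v*⟩, a ≠ 0.
-- Two distinct vertices of one class span a line through x*, so a common neighbour z would have x* in z^ζ,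
-- i.e. z ∈ H. All other counts rest on one property of polarities: if v ∉ A then v^ζ cuts A^ζ in a
-- hyperplane, so |A^ζ ∩ v^ζ| = |A^ζ| / q. Hence |x^ζ| = q^(m-1), |x^ζ ∩ H| = q^(m-2), and for x, y in
-- different classes (so that x, y, v* are independent) |x^ζ ∩ y^ζ| = q^(m-2) and |x^ζ ∩ y^ζ ∩ H| = q^(m-3);
-- removing H and passing from vectors to points divides the differences by q - 1.

module Submission where

open import Algebra.Bundles using (AbelianGroup; CommutativeRing)
open import Algebra.Structures using (IsCommutativeRing; IsAbelianGroup)
open import Data.Empty using (⊥; ⊥-elim; ⊥-elim-irr)
open import Data.Fin using (Fin; zero; suc)
import Data.Fin.Properties as Finₚ
open import Data.Fin.Permutation using (↔⇒≡)
open import Data.Irrelevant using (Irrelevant; [_])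
open import Data.Nat using (ℕ; zero; suc; _∸_; _^_; _/_; NonZero; _≤_; s≤s)
import Data.Nat as ℕ
import Data.Nat.Properties as ℕₚ
open import Data.Nat.DivMod using (m*n/n≡m)
open import Data.Product using (Σ; ∃; ∃₂; ∃-syntax; _×_; _,_; proj₁; proj₂; swap)
open import Data.Product.Function.NonDependent.Propositional using (_×-↔_)
open import Data.Refinement using (Refinement-syntax; _,_; value; value-injective)
open import Data.Sum using (_⊎_; inj₁; inj₂)
open import Data.Sum.Function.Propositional using (_⊎-↔_)
open import Data.Unit using (⊤; tt)
open import Data.Vec using (Vec; []; _∷_; map; zipWith; replicate; lookup)
open import Data.Vec.Properties
  using ( zipWith-assoc; zipWith-comm; zipWith-identityˡ; zipWith-identityʳ; map-∘; map-cong; map-id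
        ; map-replicate; lookup-zipWith; lookup-map; lookup-replicate; ≡-dec)
open import Function using (_∘_; _∘′_; id; _↔_; mk↔ₛ′; Inverse)
open import Function.Bundles using (Injection)
open import Function.Properties.Inverse using (↔-sym; ↔-trans; Inverse⇒Injection)
open import Level using (0ℓ)
open import Relation.Binary.Definitions using (DecidableEquality)
open import Relation.Binary.PropositionalEquality
open import Relation.Nullary using (¬_; Dec; yes; no; contradiction)
open import Relation.Nullary.Decidable using (map′; recompute; decidable-stable; _×-dec_; ¬?)
open import Relation.Nullary.Recomputable using (¬-recompute)
open import Relation.Unary using (Pred; Decidable)
open import Defs

open Inverse using (to; from; strictlyInverseˡ; strictlyInverseʳ)

-- A subset of a finite type is a refinement [ a ∈ A ∣ P a ]. Its membership proofs are irrelevant, so two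
-- elements are equal as soon as their values are; relevant proofs are recovered with `recompute`.
module Cardinality where

  open import Data.Nat using (_+_; _*_)
  open import Data.Nat.Properties using (m+n∸m≡n)

  private
    variable
      A B : Set
      k n : ℕ

  Card : Set → ℕ → Set
  Card A n = A ↔ Fin n

  card-unique : Card A n → Card A k → n ≡ k
  card-unique c d = ↔⇒≡ (↔-trans (↔-sym c) d)

  card-⊎ : Card A n → Card B k → Card (A ⊎ B) (n + k)
  card-⊎ c d = ↔-trans (c ⊎-↔ d) (↔-sym Finₚ.+↔⊎)

  card-× : Card A n → Card B k → Card (A × B) (n * k)
  card-× c d = ↔-trans (c ×-↔ d) (↔-sym Finₚ.*↔×)

  card-Vec : Card A n → ∀ k → Card (Vec A k) (n ^ k)
  card-Vec c zero    = mk↔ₛ′ (λ _ → zero) (λ _ → []) (λ { zero → refl }) (λ { [] → refl })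
  card-Vec c (suc k) = ↔-trans Vec-suc↔× (card-× c (card-Vec c k))
    where
    Vec-suc↔× : Vec _ (suc k) ↔ (_ × Vec _ k)
    Vec-suc↔× = mk↔ₛ′ (λ { (a ∷ v) → a , v }) (λ (a , v) → a ∷ v) (λ _ → refl) (λ { (a ∷ v) → refl })

  hasSize⇒card : HasSize A _≡_ n → Card A n
  hasSize⇒card (f , f-inj , f-surj) = mk↔ₛ′ (λ a → proj₁ (f-surj a)) f
    (λ i → f-inj _ _ (proj₂ (f-surj (f i))))
    (λ a → proj₂ (f-surj a))

  to-injective : (c : A ↔ B) → ∀ {a b} → to c a ≡ to c b → a ≡ b
  to-injective c = Injection.injective (Inverse⇒Injection c)

  from-injective : (c : A ↔ B) → ∀ {a b} → from c a ≡ from c b → a ≡ b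
  from-injective c = to-injective (↔-sym c)

  card⇒≟ : Card A n → DecidableEquality A
  card⇒≟ c a b = map′ (to-injective c) (cong (to c)) (to c a Finₚ.≟ to c b)

  card-any? : Card A n → {P : Pred A 0ℓ} → Decidable P → Dec (∃ P)
  card-any? c {P} P? = map′
    (λ (i , p) → from c i , p)
    (λ (a , p) → to c a , subst P (sym (strictlyInverseʳ c a)) p)
    (Finₚ.any? (P? ∘ from c))

  module _ {P : Pred A 0ℓ} where

    refine-cong : {Q : Pred A 0ℓ} → (∀ {a} → P a → Q a) → (∀ {a} → Q a → P a) →
                  Card [ a ∈ A ∣ P a ] n → Card [ a ∈ A ∣ Q a ] n
    refine-cong P⇒Q Q⇒P = ↔-trans (mk↔ₛ′
      (λ (a , [ q ]) → a , [ Q⇒P {a} q ]) (λ (a , [ p ]) → a , [ P⇒Q {a} p ]) (λ _ → refl) (λ _ → refl))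

    refine-↔ : (c : A ↔ B) → [ a ∈ A ∣ P a ] ↔ [ b ∈ B ∣ P (from c b) ]
    refine-↔ c = mk↔ₛ′
      (λ (a , [ p ]) → to c a , [ subst P (sym (strictlyInverseʳ c a)) p ])
      (λ (b , [ p ]) → from c b , [ p ])
      (λ (b , _) → value-injective (strictlyInverseˡ c b))
      (λ (a , _) → value-injective (strictlyInverseʳ c a))

    refine-refine : {Q : Pred A 0ℓ} → [ b ∈ [ a ∈ A ∣ P a ] ∣ Q (value b) ] ↔ [ a ∈ A ∣ P a × Q a ]
    refine-refine = mk↔ₛ′
      (λ ((a , [ p ]) , [ q ]) → a , [ p , q ]) (λ (a , [ pq ]) → (a , [ proj₁ pq ]) , [ proj₂ pq ])
      (λ _ → refl) (λ _ → refl)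

    refine-partition : Decidable P → A ↔ ([ a ∈ A ∣ P a ] ⊎ [ a ∈ A ∣ ¬ P a ])
    refine-partition P? = mk↔ₛ′ split merge split∘merge merge∘split
      where
      split : A → [ a ∈ A ∣ P a ] ⊎ [ a ∈ A ∣ ¬ P a ]
      split a with P? a
      ... | yes p = inj₁ (a , [ p ])
      ... | no ¬p = inj₂ (a , [ ¬p ])
      merge : [ a ∈ A ∣ P a ] ⊎ [ a ∈ A ∣ ¬ P a ] → A
      merge (inj₁ (a , _)) = a
      merge (inj₂ (a , _)) = a
      split∘merge : ∀ x → split (merge x) ≡ x
      split∘merge (inj₁ (a , [ p ])) with P? a
      ... | yes _ = refl
      ... | no ¬p = ⊥-elim-irr (¬p p)
      split∘merge (inj₂ (a , [ ¬p ])) with P? a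
      ... | yes p = ⊥-elim-irr (¬p p)
      ... | no _  = refl
      merge∘split : ∀ a → merge (split a) ≡ a
      merge∘split a with P? a
      ... | yes _ = refl
      ... | no _  = refl

  card-Irrelevant : Dec A → ∃[ k ] Card (Irrelevant A) k
  card-Irrelevant (yes a) = 1 , mk↔ₛ′ (λ _ → zero) (λ _ → [ a ]) (λ { zero → refl }) (λ _ → refl)
  card-Irrelevant (no ¬a) =
    0 , mk↔ₛ′ (λ { [ a ] → ⊥-elim-irr (¬a a) }) (λ ()) (λ ()) (λ { [ a ] → ⊥-elim-irr (¬a a) })

  card-refine-Fin : ∀ n {P : Pred (Fin n) 0ℓ} → Decidable P → ∃[ k ] Card [ i ∈ Fin n ∣ P i ] k
  card-refine-Fin zero    P? = 0 , mk↔ₛ′ (λ { (() , _) }) (λ ()) (λ ()) (λ { (() , _) })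
  card-refine-Fin (suc n) {P} P? =
    let k₀ , c₀ = card-Irrelevant (P? zero)
        k  , c  = card-refine-Fin n (P? ∘ suc)
    in k₀ + k , ↔-trans Fin-suc↔⊎ (card-⊎ c₀ c)
    where
    Fin-suc↔⊎ : [ i ∈ Fin (suc n) ∣ P i ] ↔ (Irrelevant (P zero) ⊎ [ i ∈ Fin n ∣ P (suc i) ])
    Fin-suc↔⊎ = mk↔ₛ′
      (λ { (zero , p) → inj₁ p ; (suc i , p) → inj₂ (i , p) })
      (λ { (inj₁ p) → zero , p ; (inj₂ (i , p)) → suc i , p })
      (λ { (inj₁ _) → refl ; (inj₂ _) → refl })
      (λ { (zero , _) → refl ; (suc _ , _) → refl })

  card-refine : Card A n → {P : Pred A 0ℓ} → Decidable P → ∃[ k ] Card [ a ∈ A ∣ P a ] k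
  card-refine {n = n} c P? =
    let k , d = card-refine-Fin n (P? ∘ from c) in k , ↔-trans (refine-↔ c) d

  card-complement : {P : Pred A 0ℓ} → Decidable P →
                    Card A n → Card [ a ∈ A ∣ P a ] k → Card [ a ∈ A ∣ ¬ P a ] (n ∸ k)
  card-complement {k = k} P? cA cP =
    let l , c¬P = card-refine cA (¬? ∘ P?)
        n≡k+l   = card-unique cA (↔-trans (refine-partition P?) (card-⊎ cP c¬P))
    in subst (Card _) (trans (sym (m+n∸m≡n k l)) (cong (_∸ k) (sym n≡k+l))) c¬P

  card-∖ : {P Q : Pred A 0ℓ} → Decidable Q →
           Card [ a ∈ A ∣ P a ] n → Card [ a ∈ A ∣ P a × Q a ] k → Card [ a ∈ A ∣ P a × ¬ Q a ] (n ∸ k)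
  card-∖ Q? cP cPQ =
    ↔-trans (↔-sym refine-refine) (card-complement (Q? ∘ value) cP (↔-trans refine-refine cPQ))

open Cardinality

module Linear (F : Field) (_≟_ : DecidableEquality (Field.Carrier F)) where

  open Field F
  open IsCommutativeRing isCommutativeRing
    using ( +-assoc; +-comm; +-identityˡ; +-identityʳ; -‿inverseˡ
          ; *-assoc; *-comm; *-identityˡ; *-identityʳ; distribˡ; distribʳ; zeroˡ; zeroʳ)

  commutativeRing : CommutativeRing 0ℓ 0ℓ
  commutativeRing = record { isCommutativeRing = isCommutativeRing }

  open import Algebra.Properties.Ring (CommutativeRing.ring commutativeRing) using (-1*x≈-x; x∙y⁻¹≈ε⇒x≈y)

  private
    variable
      n : ℕ
      c d x y : Carrier

  1≢0 : 1# ≢ 0#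
  1≢0 = 0≢1 ∘ sym

  infix 8 _⁻¹
  -- 0# ⁻¹ is the junk value 0#.
  _⁻¹ : Carrier → Carrier
  x ⁻¹ with x ≟ 0#
  ... | yes _   = 0#
  ... | no x≢0 = proj₁ (inverse x x≢0)

  ⁻¹-inverseʳ : x ≢ 0# → x * x ⁻¹ ≡ 1#
  ⁻¹-inverseʳ {x} x≢0 with x ≟ 0#
  ... | yes x≡0 = contradiction x≡0 x≢0
  ... | no x≢0′ = proj₂ (inverse x x≢0′)

  ⁻¹-inverseˡ : x ≢ 0# → x ⁻¹ * x ≡ 1#
  ⁻¹-inverseˡ {x} x≢0 = trans (*-comm (x ⁻¹) x) (⁻¹-inverseʳ x≢0)

  *-⁻¹-cancel : x ≢ 0# → ∀ y → x ⁻¹ * (x * y) ≡ y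
  *-⁻¹-cancel {x} x≢0 y =
    trans (sym (*-assoc (x ⁻¹) x y)) (trans (cong (_* y) (⁻¹-inverseˡ x≢0)) (*-identityˡ y))

  ⁻¹-unique : x * y ≡ 1# → y ≡ x ⁻¹
  ⁻¹-unique {x} {y} xy≡1 = trans (sym (*-⁻¹-cancel x≢0 y)) (trans (cong (x ⁻¹ *_) xy≡1) (*-identityʳ (x ⁻¹)))
    where
    x≢0 : x ≢ 0#
    x≢0 x≡0 = 1≢0 (trans (sym xy≡1) (trans (cong (_* y) x≡0) (zeroˡ y)))

  ⁻¹-nonzero : x ≢ 0# → x ⁻¹ ≢ 0#
  ⁻¹-nonzero {x} x≢0 x⁻¹≡0 = 1≢0 (trans (sym (⁻¹-inverseˡ x≢0)) (trans (cong (_* x) x⁻¹≡0) (zeroˡ x)))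

  *-nonzero : x ≢ 0# → y ≢ 0# → x * y ≢ 0#
  *-nonzero {x} {y} x≢0 y≢0 xy≡0 =
    y≢0 (trans (sym (*-⁻¹-cancel x≢0 y)) (trans (cong (x ⁻¹ *_) xy≡0) (zeroʳ (x ⁻¹))))

  Vector : ℕ → Set
  Vector = Vec Carrier

  infixr 7 _·_
  infixl 6 _⊕_
  infix 25 ⊖_

  _⊕_ : Vector n → Vector n → Vector n
  _⊕_ = zipWith _+_

  _·_ : Carrier → Vector n → Vector n
  c · v = map (c *_) v

  𝟎 : Vector n
  𝟎 = replicate _ 0#

  ⊖_ : Vector n → Vector n
  ⊖ v = (- 1#) · v

  ⊖-inverseˡ : (v : Vector n) → ⊖ v ⊕ v ≡ 𝟎
  ⊖-inverseˡ []      = refl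
  ⊖-inverseˡ (a ∷ v) = cong₂ _∷_ (trans (cong (_+ a) (-1*x≈-x a)) (-‿inverseˡ a)) (⊖-inverseˡ v)

  ⊖-inverseʳ : (v : Vector n) → v ⊕ ⊖ v ≡ 𝟎
  ⊖-inverseʳ v = trans (zipWith-comm +-comm v (⊖ v)) (⊖-inverseˡ v)

  ⊕-isAbelianGroup : IsAbelianGroup _≡_ (_⊕_ {n}) 𝟎 ⊖_
  ⊕-isAbelianGroup = record
    { isGroup = record
      { isMonoid = record
        { isSemigroup = record
          { isMagma = record { isEquivalence = isEquivalence ; ∙-cong = cong₂ _⊕_ }
          ; assoc   = zipWith-assoc +-assoc }
        ; identity = zipWith-identityˡ +-identityˡ , zipWith-identityʳ +-identityʳ }
      ; inverse = ⊖-inverseˡ , ⊖-inverseʳ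
      ; ⁻¹-cong = cong ⊖_ }
    ; comm = zipWith-comm +-comm }

  ⊕-abelianGroup : ℕ → AbelianGroup 0ℓ 0ℓ
  ⊕-abelianGroup n = record { isAbelianGroup = ⊕-isAbelianGroup {n} }

  module _ {n : ℕ} where
    open AbelianGroup (⊕-abelianGroup n) using (commutativeSemigroup)
    open import Algebra.Properties.AbelianGroup (⊕-abelianGroup n) public
      using () renaming (xyx⁻¹≈y to ⊕-⊖-cancelˡ; ∙-cancelʳ to ⊕-cancelʳ; x∙y⁻¹≈ε⇒x≈y to ⊖≡𝟎⇒≡)
    open import Algebra.Properties.CommutativeSemigroup commutativeSemigroup public
      using () renaming (interchange to ⊕-interchange)

    ⊕-identityˡ : (v : Vector n) → 𝟎 ⊕ v ≡ v
    ⊕-identityˡ = zipWith-identityˡ +-identityˡ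

    ⊕-identityʳ : (v : Vector n) → v ⊕ 𝟎 ≡ v
    ⊕-identityʳ = zipWith-identityʳ +-identityʳ

    ⊕-assoc : (u v w : Vector n) → u ⊕ v ⊕ w ≡ u ⊕ (v ⊕ w)
    ⊕-assoc = zipWith-assoc +-assoc

    ⊕-comm : (u v : Vector n) → u ⊕ v ≡ v ⊕ u
    ⊕-comm = zipWith-comm +-comm

    ⊕-⊖-cancelʳ : (u v : Vector n) → u ⊕ v ⊕ ⊖ v ≡ u
    ⊕-⊖-cancelʳ u v = trans (⊕-assoc u v (⊖ v)) (trans (cong (u ⊕_) (⊖-inverseʳ v)) (⊕-identityʳ u))

    ⊕-difference : (u v : Vector n) → u ⊕ (v ⊕ ⊖ u) ≡ v
    ⊕-difference u v = trans (sym (⊕-assoc u v (⊖ u))) (⊕-⊖-cancelˡ u v)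

    ⊕-transpose : {a b x y : Vector n} → a ⊕ x ≡ b ⊕ y → x ⊕ ⊖ y ≡ b ⊕ ⊖ a
    ⊕-transpose {a} {b} {x} {y} a+x≡b+y = begin
      x ⊕ ⊖ y                  ≡⟨ cong (_⊕ ⊖ y) (sym (⊕-⊖-cancelˡ a x)) ⟩
      a ⊕ x ⊕ ⊖ a ⊕ ⊖ y        ≡⟨ cong (λ z → z ⊕ ⊖ a ⊕ ⊖ y) a+x≡b+y ⟩
      b ⊕ y ⊕ ⊖ a ⊕ ⊖ y        ≡⟨ cong (_⊕ ⊖ y) (⊕-assoc b y (⊖ a)) ⟩
      b ⊕ (y ⊕ ⊖ a) ⊕ ⊖ y      ≡⟨ cong (λ z → b ⊕ z ⊕ ⊖ y) (⊕-comm y (⊖ a)) ⟩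
      b ⊕ (⊖ a ⊕ y) ⊕ ⊖ y      ≡⟨ cong (_⊕ ⊖ y) (sym (⊕-assoc b (⊖ a) y)) ⟩
      b ⊕ ⊖ a ⊕ y ⊕ ⊖ y        ≡⟨ ⊕-assoc (b ⊕ ⊖ a) y (⊖ y) ⟩
      b ⊕ ⊖ a ⊕ (y ⊕ ⊖ y)      ≡⟨ cong (b ⊕ ⊖ a ⊕_) (⊖-inverseʳ y) ⟩
      b ⊕ ⊖ a ⊕ 𝟎              ≡⟨ ⊕-identityʳ (b ⊕ ⊖ a) ⟩
      b ⊕ ⊖ a                  ∎
      where open ≡-Reasoning

  ·-distribˡ : ∀ c (u v : Vector n) → c · (u ⊕ v) ≡ c · u ⊕ c · v
  ·-distribˡ c []      []      = refl
  ·-distribˡ c (a ∷ u) (b ∷ v) = cong₂ _∷_ (distribˡ c a b) (·-distribˡ c u v)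

  ·-distribʳ : ∀ c d (v : Vector n) → (c + d) · v ≡ c · v ⊕ d · v
  ·-distribʳ c d []      = refl
  ·-distribʳ c d (a ∷ v) = cong₂ _∷_ (distribʳ a c d) (·-distribʳ c d v)

  ·-assoc : ∀ c d (v : Vector n) → c · d · v ≡ (c * d) · v
  ·-assoc c d v = trans (sym (map-∘ (c *_) (d *_) v)) (map-cong (λ a → sym (*-assoc c d a)) v)

  ·-identityˡ : (v : Vector n) → 1# · v ≡ v
  ·-identityˡ v = trans (map-cong *-identityˡ v) (map-id v)

  ·-⊖ : ∀ c (v : Vector n) → (- c) · v ≡ ⊖ (c · v)
  ·-⊖ c v = trans (cong (_· v) (sym (-1*x≈-x c))) (sym (·-assoc (- 1#) c v))

  ·-zeroˡ : (v : Vector n) → 0# · v ≡ 𝟎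
  ·-zeroˡ []      = refl
  ·-zeroˡ (a ∷ v) = cong₂ _∷_ (zeroˡ a) (·-zeroˡ v)

  ·-zeroʳ : ∀ c → c · 𝟎 {n} ≡ 𝟎
  ·-zeroʳ {n} c = trans (map-replicate (c *_) 0# n) (cong (replicate n) (zeroʳ c))

  ·-⁻¹-cancel : c ≢ 0# → (v : Vector n) → c ⁻¹ · c · v ≡ v
  ·-⁻¹-cancel {c} c≢0 v = trans (·-assoc (c ⁻¹) c v) (trans (cong (_· v) (⁻¹-inverseˡ c≢0)) (·-identityˡ v))

  ·-zero-product : c ≢ 0# → {v : Vector n} → c · v ≡ 𝟎 → v ≡ 𝟎
  ·-zero-product {c} c≢0 {v} cv≡𝟎 =
    trans (sym (·-⁻¹-cancel c≢0 v)) (trans (cong (c ⁻¹ ·_) cv≡𝟎) (·-zeroʳ (c ⁻¹)))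

  ·-cancelʳ : {v : Vector n} → v ≢ 𝟎 → c · v ≡ d · v → c ≡ d
  ·-cancelʳ {c = c} {d} {v} v≢𝟎 cv≡dv with (c + - d) ≟ 0#
  ... | yes c-d≡0 = x∙y⁻¹≈ε⇒x≈y c d c-d≡0
  ... | no c-d≢0  = contradiction (·-zero-product c-d≢0 [c-d]v≡𝟎) v≢𝟎
    where
    [c-d]v≡𝟎 : (c + - d) · v ≡ 𝟎
    [c-d]v≡𝟎 = trans (·-distribʳ c (- d) v) (trans (cong (c · v ⊕_) (·-⊖ d v))
                 (trans (cong (_⊕ ⊖ (d · v)) cv≡dv) (⊖-inverseʳ (d · v))))

  pivot : (v : Vector n) → v ≢ 𝟎 → ∃[ i ] lookup v i ≢ 0#
  pivot []      v≢𝟎 = contradiction refl v≢𝟎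
  pivot (a ∷ v) v≢𝟎 with a ≟ 0#
  ... | no a≢0  = zero , a≢0
  ... | yes a≡0 = let i , vᵢ≢0 = pivot v (v≢𝟎 ∘ cong₂ _∷_ a≡0) in suc i , vᵢ≢0

  lead : Vector n → Carrier
  lead []      = 0#
  lead (a ∷ v) with a ≟ 0#
  ... | yes _ = lead v
  ... | no _  = a

  lead≡0⇒𝟎 : (v : Vector n) → lead v ≡ 0# → v ≡ 𝟎
  lead≡0⇒𝟎 []      _ = refl
  lead≡0⇒𝟎 (a ∷ v) lead≡0 with a ≟ 0#
  ... | yes a≡0 = cong₂ _∷_ a≡0 (lead≡0⇒𝟎 v lead≡0)
  ... | no a≢0  = contradiction lead≡0 a≢0

  lead-nonzero : {v : Vector n} → v ≢ 𝟎 → lead v ≢ 0#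
  lead-nonzero v≢𝟎 = v≢𝟎 ∘ lead≡0⇒𝟎 _

  lead-𝟎 : lead (𝟎 {n}) ≡ 0#
  lead-𝟎 {zero}  = refl
  lead-𝟎 {suc n} with 0# ≟ 0#
  ... | yes _   = lead-𝟎 {n}
  ... | no 0≢0 = contradiction refl 0≢0

  lead-· : c ≢ 0# → (v : Vector n) → lead (c · v) ≡ c * lead v
  lead-· c≢0 []      = sym (zeroʳ _)
  lead-· {c = c} c≢0 (a ∷ v) with a ≟ 0# | (c * a) ≟ 0#
  ... | yes _   | yes _    = lead-· c≢0 v
  ... | yes a≡0 | no ca≢0 = contradiction (trans (cong (c *_) a≡0) (zeroʳ c)) ca≢0
  ... | no a≢0  | yes ca≡0 = contradiction ca≡0 (*-nonzero c≢0 a≢0)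
  ... | no _    | no _     = refl

  Normalised : Vector n → Set
  Normalised v = lead v ≡ 1#

  normalise : Vector n → Vector n
  normalise v = lead v ⁻¹ · v

  normalised⇒nonzero : {v : Vector n} → Normalised v → v ≢ 𝟎
  normalised⇒nonzero {n} lead≡1 v≡𝟎 = 1≢0 (trans (sym lead≡1) (trans (cong lead v≡𝟎) (lead-𝟎 {n})))

  normalise-normalised : {v : Vector n} → v ≢ 𝟎 → Normalised (normalise v)
  normalise-normalised {v = v} v≢𝟎 =
    trans (lead-· (⁻¹-nonzero (lead-nonzero v≢𝟎)) v) (⁻¹-inverseˡ (lead-nonzero v≢𝟎))

  lead·normalise : {v : Vector n} → v ≢ 𝟎 → lead v · normalise v ≡ v
  lead·normalise {v = v} v≢𝟎 =
    trans (·-assoc _ _ v) (trans (cong (_· v) (⁻¹-inverseʳ (lead-nonzero v≢𝟎))) (·-identityˡ v))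

  normalised-scalar : {u v : Vector n} → Normalised u → Normalised v → v ≡ c · u → c ≡ 1#
  normalised-scalar {c = c} {u} {v} u-nrm v-nrm v≡cu with c ≟ 0#
  ... | yes c≡0 = contradiction (trans v≡cu (trans (cong (_· u) c≡0) (·-zeroˡ u))) (normalised⇒nonzero v-nrm)
  ... | no c≢0  = begin
    c            ≡⟨ sym (*-identityʳ c) ⟩
    c * 1#       ≡⟨ cong (c *_) (sym u-nrm) ⟩
    c * lead u   ≡⟨ sym (lead-· c≢0 u) ⟩
    lead (c · u) ≡⟨ cong lead (sym v≡cu) ⟩
    lead v       ≡⟨ v-nrm ⟩
    1#           ∎
    where open ≡-Reasoning

  normalised-unique : {u v : Vector n} → Normalised u → Normalised v → v ≡ c · u → v ≡ u
  normalised-unique {u = u} u-nrm v-nrm v≡cu =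
    trans v≡cu (trans (cong (_· u) (normalised-scalar u-nrm v-nrm v≡cu)) (·-identityˡ u))

  normalise-· : c ≢ 0# → {v : Vector n} → v ≢ 𝟎 → normalise (c · v) ≡ normalise v
  normalise-· {c = c} c≢0 {v} v≢𝟎 = begin
    lead (c · v) ⁻¹ · c · v        ≡⟨ ·-assoc _ c v ⟩
    (lead (c · v) ⁻¹ * c) · v      ≡⟨ cong (λ s → (s ⁻¹ * c) · v) (lead-· c≢0 v) ⟩
    ((c * lead v) ⁻¹ * c) · v      ≡⟨ cong (_· v) (⁻¹-unique l*[cl⁻¹c]≡1) ⟩
    lead v ⁻¹ · v                  ∎
    where
    open ≡-Reasoning
    l*[cl⁻¹c]≡1 : lead v * ((c * lead v) ⁻¹ * c) ≡ 1#
    l*[cl⁻¹c]≡1 = begin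
      lead v * ((c * lead v) ⁻¹ * c)   ≡⟨ cong (lead v *_) (*-comm _ c) ⟩
      lead v * (c * (c * lead v) ⁻¹)   ≡⟨ sym (*-assoc (lead v) c _) ⟩
      lead v * c * (c * lead v) ⁻¹     ≡⟨ cong (_* (c * lead v) ⁻¹) (*-comm (lead v) c) ⟩
      c * lead v * (c * lead v) ⁻¹     ≡⟨ ⁻¹-inverseʳ (*-nonzero c≢0 (lead-nonzero v≢𝟎)) ⟩
      1#                               ∎

  normalise-id : {v : Vector n} → Normalised v → normalise v ≡ v
  normalise-id {v = v} lead≡1 =
    trans (cong (λ x → x ⁻¹ · v) lead≡1) (trans (cong (_· v) (sym 1≡1⁻¹)) (·-identityˡ v))
    where
    1≡1⁻¹ : 1# ≡ 1# ⁻¹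
    1≡1⁻¹ = ⁻¹-unique (*-identityʳ 1#)

module FiniteSpace (F : Field) (p : ℕ) (card-C : Card (Field.Carrier F) (suc p)) (m : ℕ) where

  open Field F

  infix 4 _≟_
  _≟_ : DecidableEquality Carrier
  _≟_ = card⇒≟ card-C

  open Linear F _≟_ public
  open IsCommutativeRing isCommutativeRing using (+-identityˡ; -‿inverseʳ; *-assoc; *-identityʳ; zeroʳ)
  open import Algebra.Properties.Ring (CommutativeRing.ring commutativeRing) using (-1*x≈-x; x∙y⁻¹≈ε⇒x≈y)
  open Geometry F m using (Vect; Subspace; _∋_; ∋-𝟎; ∋-⊕; ∋-·; _⊆_; _≐_; IsPoint)

  infix 4 _≟ᵥ_
  _≟ᵥ_ : DecidableEquality Vect
  _≟ᵥ_ = ≡-dec _≟_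

  q : ℕ
  q = suc p

  card-V : Card Vect (q ^ m)
  card-V = card-Vec card-C m

  𝟘 : Subspace
  𝟘 = record
    { _∋_ = _≡ 𝟎 ; ∋-𝟎 = refl
    ; ∋-⊕ = λ { refl refl → ⊕-identityˡ 𝟎 } ; ∋-· = λ { c refl → ·-zeroʳ c } }

  𝕍 : Subspace
  𝕍 = record { _∋_ = λ _ → ⊤ ; ∋-𝟎 = tt ; ∋-⊕ = λ _ _ → tt ; ∋-· = λ _ _ → tt }

  ⟨_⟩ : Vect → Subspace
  ⟨ v ⟩ = record
    { _∋_ = λ w → ∃[ c ] w ≡ c · v
    ; ∋-𝟎 = 0# , sym (·-zeroˡ v)
    ; ∋-⊕ = λ { (c , refl) (d , refl) → c + d , sym (·-distribʳ c d v) }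
    ; ∋-· = λ { c (d , refl) → c * d , ·-assoc c d v } }

  infixl 23 _∩ₛ_
  infixl 22 _+ₛ_

  _∩ₛ_ : Subspace → Subspace → Subspace
  S ∩ₛ T = record
    { _∋_ = λ v → S ∋ v × T ∋ v
    ; ∋-𝟎 = ∋-𝟎 S , ∋-𝟎 T
    ; ∋-⊕ = λ (s , t) (s′ , t′) → ∋-⊕ S s s′ , ∋-⊕ T t t′
    ; ∋-· = λ c (s , t) → ∋-· S c s , ∋-· T c t }

  _+ₛ_ : Subspace → Subspace → Subspace
  S +ₛ T = record
    { _∋_ = λ u → ∃₂ λ s t → S ∋ s × T ∋ t × u ≡ s ⊕ t
    ; ∋-𝟎 = 𝟎 , 𝟎 , ∋-𝟎 S , ∋-𝟎 T , sym (⊕-identityˡ 𝟎)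
    ; ∋-⊕ = λ { (s , t , s∈ , t∈ , refl) (s′ , t′ , s′∈ , t′∈ , refl) →
                s ⊕ s′ , t ⊕ t′ , ∋-⊕ S s∈ s′∈ , ∋-⊕ T t∈ t′∈ , ⊕-interchange s t s′ t′ }
    ; ∋-· = λ { c (s , t , s∈ , t∈ , refl) → c · s , c · t , ∋-· S c s∈ , ∋-· T c t∈ , ·-distribˡ c s t } }

  ∋-⊖ : ∀ S {u} → S ∋ u → S ∋ ⊖ u
  ∋-⊖ S = ∋-· S (- 1#)

  ⟨⟩-∋ : ∀ v → ⟨ v ⟩ ∋ v
  ⟨⟩-∋ v = 1# , sym (·-identityˡ v)

  ⟨⟩-⊆ : ∀ {S v} → S ∋ v → ⟨ v ⟩ ⊆ S
  ⟨⟩-⊆ {S} v∈S _ (c , refl) = ∋-· S c v∈S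

  +ₛ-⊆ˡ : ∀ {S T} → S ⊆ S +ₛ T
  +ₛ-⊆ˡ {T = T} s s∈S = s , 𝟎 , s∈S , ∋-𝟎 T , sym (⊕-identityʳ s)

  +ₛ-⊆ʳ : ∀ {S T} → T ⊆ S +ₛ T
  +ₛ-⊆ʳ {S = S} t t∈T = 𝟎 , t , ∋-𝟎 S , t∈T , sym (⊕-identityˡ t)

  +ₛ-lub : ∀ {S T U} → S ⊆ U → T ⊆ U → S +ₛ T ⊆ U
  +ₛ-lub {U = U} S⊆U T⊆U _ (s , t , s∈ , t∈ , refl) = ∋-⊕ U (S⊆U s s∈) (T⊆U t t∈)

  ≐-sym : ∀ {S T} → S ≐ T → T ≐ S
  ≐-sym (S⊆T , T⊆S) = T⊆S , S⊆T

  ≐-trans : ∀ {S T U} → S ≐ T → T ≐ U → S ≐ U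
  ≐-trans (S⊆T , T⊆S) (T⊆U , U⊆T) = (λ v → T⊆U v ∘′ S⊆T v) , (λ v → T⊆S v ∘′ U⊆T v)

  ∉-· : ∀ S {c v} → c ≢ 0# → ¬ S ∋ v → ¬ S ∋ (c · v)
  ∉-· S {c} {v} c≢0 v∉S cv∈S = v∉S (subst (S ∋_) (·-⁻¹-cancel c≢0 v) (∋-· S (c ⁻¹) cv∈S))

  ⟨⟩-· : ∀ {c v} → c ≢ 0# → ⟨ c · v ⟩ ≐ ⟨ v ⟩
  ⟨⟩-· {c} {v} c≢0 = ⟨⟩-⊆ {⟨ v ⟩} (c , refl) , ⟨⟩-⊆ {⟨ c · v ⟩} (c ⁻¹ , sym (·-⁻¹-cancel c≢0 v))

  ⟨⟩-≐ : ∀ {u v} → u ≢ 𝟎 → ⟨ v ⟩ ∋ u → ⟨ u ⟩ ≐ ⟨ v ⟩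
  ⟨⟩-≐ {u} {v} u≢𝟎 (c , u≡cv) = subst (λ r → ⟨ r ⟩ ≐ ⟨ v ⟩) (sym u≡cv) (⟨⟩-· c≢0)
    where
    c≢0 : c ≢ 0#
    c≢0 c≡0 = u≢𝟎 (trans u≡cv (trans (cong (_· v) c≡0) (·-zeroˡ v)))

  ⟨⟩-∋-sym : ∀ {u v} → u ≢ 𝟎 → ⟨ v ⟩ ∋ u → ⟨ u ⟩ ∋ v
  ⟨⟩-∋-sym {u} {v} u≢𝟎 u∈⟨v⟩ = proj₂ (⟨⟩-≐ u≢𝟎 u∈⟨v⟩) v (⟨⟩-∋ v)

  ⟨⟩-isPoint : ∀ {v} → v ≢ 𝟎 → IsPoint ⟨ v ⟩
  ⟨⟩-isPoint {v} v≢𝟎 = v , v≢𝟎 , λ _ → id , id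

  isPoint-≐ : ∀ S (S-point : IsPoint S) → S ≐ ⟨ proj₁ S-point ⟩
  isPoint-≐ _ (_ , _ , spans) = (λ w → proj₁ (spans w)) , (λ w → proj₂ (spans w))

  ker : Fin m → Subspace
  ker i = record
    { _∋_ = λ w → lookup w i ≡ 0#
    ; ∋-𝟎 = lookup-replicate i 0#
    ; ∋-⊕ = λ {u} {v} uᵢ≡0 vᵢ≡0 →
              trans (lookup-zipWith _+_ i u v) (trans (cong₂ _+_ uᵢ≡0 vᵢ≡0) (+-identityˡ 0#))
    ; ∋-· = λ c {v} vᵢ≡0 → trans (lookup-map i (c *_) v) (trans (cong (c *_) vᵢ≡0) (zeroʳ c)) }

  module _ {v : Vect} {i : Fin m} (vᵢ≢0 : lookup v i ≢ 0#) where

    ⟨⟩∩ker⊆𝟘 : ⟨ v ⟩ ∩ₛ ker i ⊆ 𝟘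
    ⟨⟩∩ker⊆𝟘 _ ((c , refl) , cvᵢ≡0) with c ≟ 0#
    ... | yes c≡0 = trans (cong (_· v) c≡0) (·-zeroˡ v)
    ... | no c≢0  = contradiction (trans (sym (lookup-map i (c *_) v)) cvᵢ≡0) (*-nonzero c≢0 vᵢ≢0)

    ⟨⟩+ker-full : ∀ w → (⟨ v ⟩ +ₛ ker i) ∋ w
    ⟨⟩+ker-full w = a · v , w ⊕ ⊖ (a · v) , (a , refl) , [w-av]ᵢ≡0 , sym (⊕-difference (a · v) w)
      where
      open ≡-Reasoning
      wᵢ = lookup w i
      a = wᵢ * lookup v i ⁻¹
      [av]ᵢ≡wᵢ : lookup (a · v) i ≡ wᵢ
      [av]ᵢ≡wᵢ = begin
        lookup (a · v) i            ≡⟨ lookup-map i (a *_) v ⟩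
        wᵢ * lookup v i ⁻¹ * lookup v i   ≡⟨ *-assoc wᵢ _ _ ⟩
        wᵢ * (lookup v i ⁻¹ * lookup v i) ≡⟨ cong (wᵢ *_) (⁻¹-inverseˡ vᵢ≢0) ⟩
        wᵢ * 1#                     ≡⟨ *-identityʳ wᵢ ⟩
        wᵢ                          ∎
      [w-av]ᵢ≡0 : lookup (w ⊕ ⊖ (a · v)) i ≡ 0#
      [w-av]ᵢ≡0 = begin
        lookup (w ⊕ ⊖ (a · v)) i           ≡⟨ lookup-zipWith _+_ i w _ ⟩
        wᵢ + lookup (⊖ (a · v)) i          ≡⟨ cong (wᵢ +_) (lookup-map i (- 1# *_) (a · v)) ⟩
        wᵢ + - 1# * lookup (a · v) i       ≡⟨ cong (λ x → wᵢ + - 1# * x) [av]ᵢ≡wᵢ ⟩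
        wᵢ + - 1# * wᵢ                     ≡⟨ cong (wᵢ +_) (-1*x≈-x wᵢ) ⟩
        wᵢ + - wᵢ                          ≡⟨ -‿inverseʳ wᵢ ⟩
        0#                                 ∎

  ⊕·-injective : ∀ B {b b′ w c c′} → B ∋ b → B ∋ b′ → ¬ B ∋ w →
                 b ⊕ c · w ≡ b′ ⊕ c′ · w → c ≡ c′ × b ≡ b′
  ⊕·-injective B {b} {b′} {w} {c} {c′} b∈B b′∈B w∉B b+cw≡b′+c′w =
    c≡c′ , ⊕-cancelʳ (c · w) b b′ (trans b+cw≡b′+c′w (cong (λ x → b′ ⊕ x · w) (sym c≡c′)))
    where
    [c-c′]w∈B : B ∋ ((c + - c′) · w)
    [c-c′]w∈B = subst (B ∋_)
      (sym (trans (·-distribʳ c (- c′) w) (trans (cong (c · w ⊕_) (·-⊖ c′ w)) (⊕-transpose b+cw≡b′+c′w))))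
      (∋-⊕ B b′∈B (∋-⊖ B b∈B))
    c≡c′ : c ≡ c′
    c≡c′ with (c + - c′) ≟ 0#
    ... | yes c-c′≡0 = x∙y⁻¹≈ε⇒x≈y c c′ c-c′≡0
    ... | no c-c′≢0  = contradiction (subst (B ∋_) (·-⁻¹-cancel c-c′≢0 w) (∋-· B _ [c-c′]w∈B)) w∉B

  ⟨⟩? : ∀ v → Decidable (⟨ v ⟩ ∋_)
  ⟨⟩? v u = card-any? card-C (λ c → u ≟ᵥ c · v)

  card-nonzero : Card [ c ∈ Carrier ∣ c ≢ 0# ] p
  card-nonzero = card-complement (_≟ 0#) card-C card-zero
    where
    card-zero : Card [ c ∈ Carrier ∣ c ≡ 0# ] 1
    card-zero = mk↔ₛ′ (λ _ → zero) (λ _ → 0# , [ refl ]) (λ { zero → refl })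
                      (λ (c , [ c≡0 ]) → value-injective (sym (recompute (c ≟ 0#) c≡0)))

  card-⟨⟩∖𝟎 : ∀ {w} → w ≢ 𝟎 → Card [ u ∈ Vect ∣ ⟨ w ⟩ ∋ u × u ≢ 𝟎 ] p
  card-⟨⟩∖𝟎 {w} w≢𝟎 = ↔-trans (↔-sym multiples-↔) card-nonzero
    where
    coefficient : ∀ {u} → .(⟨ w ⟩ ∋ u) → ⟨ w ⟩ ∋ u
    coefficient {u} = recompute (⟨⟩? w u)
    multiples-↔ : [ c ∈ Carrier ∣ c ≢ 0# ] ↔ [ u ∈ Vect ∣ ⟨ w ⟩ ∋ u × u ≢ 𝟎 ]
    multiples-↔ = mk↔ₛ′
      (λ (c , [ c≢0 ]) → c · w , [ (c , refl) , w≢𝟎 ∘ ·-zero-product c≢0 ])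
      (λ (u , [ u∈ ]) → let c , u≡cw = coefficient (proj₁ u∈)
                         in c , [ (λ c≡0 → proj₂ u∈ (trans u≡cw (trans (cong (_· w) c≡0) (·-zeroˡ w)))) ])
      (λ (u , [ u∈ ]) → value-injective (sym (proj₂ (coefficient (proj₁ u∈)))))
      (λ (c , _) → value-injective (sym (·-cancelʳ w≢𝟎 (proj₂ (coefficient {c · w} (c , refl))))))

  module _ {D : Pred Vect 0ℓ} (D? : Decidable D)
           (D-nonzero : ∀ {v} → D v → v ≢ 𝟎) (D-scale : ∀ {c v} → c ≢ 0# → D v → D (c · v)) where

    normalise-↔ : ([ c ∈ Carrier ∣ c ≢ 0# ] × [ v ∈ Vect ∣ Normalised v × D v ]) ↔ [ v ∈ Vect ∣ D v ]
    normalise-↔ = mk↔ₛ′ scale unscale scale∘unscale unscale∘scale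
      where
      scale : [ c ∈ Carrier ∣ c ≢ 0# ] × [ v ∈ Vect ∣ Normalised v × D v ] → [ v ∈ Vect ∣ D v ]
      scale ((c , [ c≢0 ]) , (v , [ nrm-Dv ])) = c · v , [ D-scale c≢0 (proj₂ nrm-Dv) ]
      unscale : [ v ∈ Vect ∣ D v ] → [ c ∈ Carrier ∣ c ≢ 0# ] × [ v ∈ Vect ∣ Normalised v × D v ]
      unscale (v , [ Dv ]) =
        (lead v , [ lead-nonzero (D-nonzero Dv) ]) ,
        (normalise v , [ normalise-normalised (D-nonzero Dv) , D-scale (⁻¹-nonzero (lead-nonzero (D-nonzero Dv))) Dv ])
      scale∘unscale : ∀ x → scale (unscale x) ≡ x
      scale∘unscale (v , [ Dv ]) = value-injective (lead·normalise (¬-recompute (D-nonzero Dv)))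
      unscale∘scale : ∀ x → unscale (scale x) ≡ x
      unscale∘scale ((c , [ c≢0 ]) , (v , [ nrm-Dv ])) = cong₂ _,_
        (value-injective (trans (lead-· c≢0′ v) (trans (cong (c *_) lead≡1) (*-identityʳ c))))
        (value-injective
          (trans (normalise-· c≢0′ (¬-recompute (D-nonzero (proj₂ nrm-Dv)))) (normalise-id lead≡1)))
        where
        c≢0′ = ¬-recompute c≢0
        lead≡1 = recompute (lead v ≟ 1#) (proj₁ nrm-Dv)

    card-normalised : ∀ {l} → Card [ v ∈ Vect ∣ D v ] l →
                      ∃[ n ] Card [ v ∈ Vect ∣ Normalised v × D v ] n × p ℕ.* n ≡ l
    card-normalised card-D =
      let n , card-N = card-refine card-V (λ v → (lead v ≟ 1#) ×-dec D? v)
      in n , card-N , card-unique (↔-trans (↔-sym normalise-↔) (card-× card-nonzero card-N)) card-D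

    card-normalised-exact : ∀ {n} .{{_ : NonZero p}} → Card [ v ∈ Vect ∣ D v ] (p ℕ.* n) →
                            Card [ v ∈ Vect ∣ Normalised v × D v ] n
    card-normalised-exact {n} card-D =
      let n′ , card-N , p*n′≡p*n = card-normalised card-D
      in subst (Card _) (ℕₚ.*-cancelˡ-≡ n′ n p p*n′≡p*n) card-N

module Polarity (F : Field) (p : ℕ) (card-C : Card (Field.Carrier F) (suc p)) (m : ℕ)
                (ζ : Geometry.Subspace F m → Geometry.Subspace F m)
                (ζ-polarity : Geometry.IsPolarity F m ζ) where

  open Field F
  open FiniteSpace F p card-C m
  open Geometry F m using (Vect; Subspace; _∋_; ∋-𝟎; ∋-⊕; ∋-·; _⊆_; _≐_; IsPolarity)
  open IsPolarity ζ-polarity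

  ζ-antitone : ∀ {S T} → S ⊆ T → ζ T ⊆ ζ S
  ζ-antitone = reverses _ _

  ζζ-⊆ : ∀ S → ζ (ζ S) ⊆ S
  ζζ-⊆ S = proj₁ (involutive S)

  ⊆-ζζ : ∀ S → S ⊆ ζ (ζ S)
  ⊆-ζζ S = proj₂ (involutive S)

  ⊆ζ-sym : ∀ {S T} → S ⊆ ζ T → T ⊆ ζ S
  ⊆ζ-sym {S} {T} S⊆ζT v v∈T = ζ-antitone {S} {ζ T} S⊆ζT v (⊆-ζζ T v v∈T)

  ζ⟨⟩-sym : ∀ {u v} → ζ ⟨ v ⟩ ∋ u → ζ ⟨ u ⟩ ∋ v
  ζ⟨⟩-sym {u} {v} u∈ζ⟨v⟩ = ⊆ζ-sym {⟨ u ⟩} {⟨ v ⟩} (⟨⟩-⊆ {ζ ⟨ v ⟩} {u} u∈ζ⟨v⟩) v (⟨⟩-∋ v)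

  ζ-cong : ∀ {S T} → S ≐ T → ζ S ≐ ζ T
  ζ-cong {S} {T} (S⊆T , T⊆S) = ζ-antitone {T} {S} T⊆S , ζ-antitone {S} {T} S⊆T

  ζ-𝟘 : ∀ v → ζ 𝟘 ∋ v
  ζ-𝟘 v = ζ-antitone {𝟘} {ζ 𝕍} (λ { _ refl → ∋-𝟎 (ζ 𝕍) }) v (⊆-ζζ 𝕍 v tt)

  ζ-𝕍 : ζ 𝕍 ⊆ 𝟘
  ζ-𝕍 v v∈ = ζζ-⊆ 𝟘 v (ζ-antitone {ζ 𝟘} {𝕍} (λ _ _ → tt) v v∈)

  ζ-null⇒𝕍 : ∀ {U} → ζ U ⊆ 𝟘 → ∀ v → U ∋ v
  ζ-null⇒𝕍 {U} ζU⊆𝟘 v = ζζ-⊆ U v (ζ-antitone {ζ U} {𝟘} ζU⊆𝟘 v (ζ-𝟘 v))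

  ζ-+ₛ : ∀ {S T} → ζ S ∩ₛ ζ T ⊆ ζ (S +ₛ T)
  ζ-+ₛ {S} {T} = ⊆ζ-sym {S +ₛ T} {ζ S ∩ₛ ζ T} (+ₛ-lub {S} {T} {ζ (ζ S ∩ₛ ζ T)}
    (⊆ζ-sym {ζ S ∩ₛ ζ T} {S} (λ _ → proj₁)) (⊆ζ-sym {ζ S ∩ₛ ζ T} {T} (λ _ → proj₂)))

  ζ-∩ₛ : ∀ {S T} → ζ (S ∩ₛ T) ⊆ ζ S +ₛ ζ T
  ζ-∩ₛ {S} {T} v v∈ = ζζ-⊆ (ζ S +ₛ ζ T) v (ζ-antitone {ζ (ζ S +ₛ ζ T)} {S ∩ₛ T} ζ[ζS+ζT]⊆S∩T v v∈)
    where
    ζ[ζS+ζT]⊆S∩T : ζ (ζ S +ₛ ζ T) ⊆ S ∩ₛ T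
    ζ[ζS+ζT]⊆S∩T v v∈ = ζζ-⊆ S v (ζ-antitone {ζ S} {ζ S +ₛ ζ T} (+ₛ-⊆ˡ {ζ S} {ζ T}) v v∈)
                       , ζζ-⊆ T v (ζ-antitone {ζ T} {ζ S +ₛ ζ T} (+ₛ-⊆ʳ {ζ S} {ζ T}) v v∈)

  -- u splits as s + t along ζ S + ζ T ⊇ ζ (S ∩ T) = 𝕍, and u ∈ ζ S iff t = 0 since ζ S ∩ ζ T ⊆ ζ 𝕍 = 0.
  ζ-decidable : ∀ {S T} → S ∩ₛ T ⊆ 𝟘 → (∀ v → (S +ₛ T) ∋ v) → Decidable (ζ S ∋_)
  ζ-decidable {S} {T} S∩T⊆𝟘 S+T-full u
    with ζ-∩ₛ {S} {T} u (ζ-antitone {S ∩ₛ T} {𝟘} S∩T⊆𝟘 u (ζ-𝟘 u))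
  ... | s , t , s∈ζS , t∈ζT , u≡s+t with t ≟ᵥ 𝟎
  ...   | yes t≡𝟎 = yes (subst (ζ S ∋_) (sym (trans u≡s+t (trans (cong (s ⊕_) t≡𝟎) (⊕-identityʳ s)))) s∈ζS)
  ...   | no t≢𝟎  = no λ u∈ζS → t≢𝟎 (ζ-𝕍 t (ζ-antitone {𝕍} {S +ₛ T} (λ v _ → S+T-full v) t
                                         (ζ-+ₛ {S} {T} t (t∈ζS u∈ζS , t∈ζT))))
    where
    t∈ζS : ζ S ∋ u → ζ S ∋ t
    t∈ζS u∈ζS = subst (ζ S ∋_) (trans (cong (_⊕ ⊖ s) u≡s+t) (⊕-⊖-cancelˡ s t))
                      (∋-⊕ (ζ S) u∈ζS (∋-⊖ (ζ S) s∈ζS))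

  ζ⟨⟩-decidable : ∀ {v} → v ≢ 𝟎 → Decidable (ζ ⟨ v ⟩ ∋_)
  ζ⟨⟩-decidable {v} v≢𝟎 =
    let _ , vᵢ≢0 = pivot v v≢𝟎 in ζ-decidable {T = ker _} (⟨⟩∩ker⊆𝟘 vᵢ≢0) (⟨⟩+ker-full vᵢ≢0)

  ζ⟨⟩-complement : ∀ {v w} → ¬ ζ ⟨ v ⟩ ∋ w → ∀ u → ∃₂ λ s c → ζ ⟨ v ⟩ ∋ s × u ≡ s ⊕ c · w
  ζ⟨⟩-complement {v} {w} w∉ζ⟨v⟩ u with ζ-null⇒𝕍 {ζ ⟨ v ⟩ +ₛ ⟨ w ⟩} ζ[ζ⟨v⟩+⟨w⟩]⊆𝟘 u
    where
    ζ[ζ⟨v⟩+⟨w⟩]⊆𝟘 : ζ (ζ ⟨ v ⟩ +ₛ ⟨ w ⟩) ⊆ 𝟘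
    ζ[ζ⟨v⟩+⟨w⟩]⊆𝟘 x x∈
      with ζζ-⊆ ⟨ v ⟩ x (ζ-antitone {ζ ⟨ v ⟩} {ζ ⟨ v ⟩ +ₛ ⟨ w ⟩} (+ₛ-⊆ˡ {ζ ⟨ v ⟩} {⟨ w ⟩}) x x∈)
    ... | c , refl with c ≟ 0#
    ...   | yes c≡0 = trans (cong (_· v) c≡0) (·-zeroˡ v)
    ...   | no c≢0  = contradiction (ζ⟨⟩-sym v∈ζ⟨w⟩) w∉ζ⟨v⟩
      where
      cv∈ζ⟨w⟩ : ζ ⟨ w ⟩ ∋ (c · v)
      cv∈ζ⟨w⟩ = ζ-antitone {⟨ w ⟩} {ζ ⟨ v ⟩ +ₛ ⟨ w ⟩} (+ₛ-⊆ʳ {ζ ⟨ v ⟩} {⟨ w ⟩}) (c · v) x∈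
      v∈ζ⟨w⟩ : ζ ⟨ w ⟩ ∋ v
      v∈ζ⟨w⟩ = subst (ζ ⟨ w ⟩ ∋_) (·-⁻¹-cancel c≢0 v) (∋-· (ζ ⟨ w ⟩) (c ⁻¹) cv∈ζ⟨w⟩)
  ... | s , t , s∈ , (c , t≡cw) , u≡s+t = s , c , s∈ , trans u≡s+t (cong (s ⊕_) t≡cw)

  module _ {A : Subspace} {v w : Vect} (w∈ζA : ζ A ∋ w) (w∉ζ⟨v⟩ : ¬ ζ ⟨ v ⟩ ∋ w) where

    ζ-section-↔ : ([ u ∈ Vect ∣ ζ A ∋ u × ζ ⟨ v ⟩ ∋ u ] × Carrier) ↔ [ u ∈ Vect ∣ ζ A ∋ u ]
    ζ-section-↔ = mk↔ₛ′ join split join∘split split∘join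
      where
      join : [ u ∈ Vect ∣ ζ A ∋ u × ζ ⟨ v ⟩ ∋ u ] × Carrier → [ u ∈ Vect ∣ ζ A ∋ u ]
      join ((b , [ b∈ ]) , c) = b ⊕ c · w , [ ∋-⊕ (ζ A) (proj₁ b∈) (∋-· (ζ A) c w∈ζA) ]

      split : [ u ∈ Vect ∣ ζ A ∋ u ] → [ u ∈ Vect ∣ ζ A ∋ u × ζ ⟨ v ⟩ ∋ u ] × Carrier
      split (u , [ u∈ζA ]) =
        let s , c , s∈ζ⟨v⟩ , u≡s+cw = ζ⟨⟩-complement w∉ζ⟨v⟩ u
            s∈ζA = λ u∈ζA → subst (ζ A ∋_)
                     (trans (cong (_⊕ ⊖ (c · w)) u≡s+cw) (⊕-⊖-cancelʳ s (c · w)))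
                     (∋-⊕ (ζ A) u∈ζA (∋-⊖ (ζ A) (∋-· (ζ A) c w∈ζA)))
        in (s , [ s∈ζA u∈ζA , s∈ζ⟨v⟩ ]) , c

      join∘split : ∀ x → join (split x) ≡ x
      join∘split (u , _) = value-injective (sym (proj₂ (proj₂ (proj₂ (ζ⟨⟩-complement w∉ζ⟨v⟩ u)))))

      split∘join : ∀ x → split (join x) ≡ x
      split∘join ((b , [ b∈ ]) , c) =
        let s , c′ , s∈ζ⟨v⟩ , b+cw≡s+c′w = ζ⟨⟩-complement w∉ζ⟨v⟩ (b ⊕ c · w)
            c≡c′ = recompute (c ≟ c′)
                     (proj₁ (⊕·-injective (ζ ⟨ v ⟩) (proj₂ b∈) s∈ζ⟨v⟩ w∉ζ⟨v⟩ b+cw≡s+c′w))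
            b≡s  = recompute (b ≟ᵥ s)
                     (proj₂ (⊕·-injective (ζ ⟨ v ⟩) (proj₂ b∈) s∈ζ⟨v⟩ w∉ζ⟨v⟩ b+cw≡s+c′w))
        in cong₂ _,_ (value-injective (sym b≡s)) (sym c≡c′)

  module _ {A : Subspace} (ζA? : Decidable (ζ A ∋_)) {v : Vect} (v∉A : ¬ A ∋ v) where

    private
      ζ⟨v⟩? : Decidable (ζ ⟨ v ⟩ ∋_)
      ζ⟨v⟩? = ζ⟨⟩-decidable λ { refl → v∉A (∋-𝟎 A) }

    ζ⊈ζ⟨⟩ : ∃ λ w → ζ A ∋ w × ¬ ζ ⟨ v ⟩ ∋ w
    ζ⊈ζ⟨⟩ with card-any? card-V (λ w → ζA? w ×-dec ¬? (ζ⟨v⟩? w))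
    ... | yes found = found
    ... | no none   = contradiction v∈A v∉A
      where
      ζA⊆ζ⟨v⟩ : ζ A ⊆ ζ ⟨ v ⟩
      ζA⊆ζ⟨v⟩ w w∈ζA = decidable-stable (ζ⟨v⟩? w) (λ w∉ → none (w , w∈ζA , w∉))
      v∈A : A ∋ v
      v∈A = ζζ-⊆ A v (ζ-antitone {ζ A} {ζ ⟨ v ⟩} ζA⊆ζ⟨v⟩ v (⊆-ζζ ⟨ v ⟩ v (⟨⟩-∋ v)))

    card-ζ-section : ∀ {n} → Card [ u ∈ Vect ∣ ζ A ∋ u ] (q ^ suc n) →
                     Card [ u ∈ Vect ∣ ζ A ∋ u × ζ ⟨ v ⟩ ∋ u ] (q ^ n)
    card-ζ-section {n} card-ζA =
      let _ , w∈ζA , w∉ζ⟨v⟩ = ζ⊈ζ⟨⟩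
          k , card-section = card-refine card-V (λ u → ζA? u ×-dec ζ⟨v⟩? u)
          k*q≡q*qⁿ = card-unique
                       (↔-trans (↔-sym (ζ-section-↔ w∈ζA w∉ζ⟨v⟩)) (card-× card-section card-C)) card-ζA
      in subst (Card _) (ℕₚ.*-cancelʳ-≡ k (q ^ n) q (trans k*q≡q*qⁿ (ℕₚ.*-comm q (q ^ n)))) card-section

  card-ζ𝟘 : Card [ u ∈ Vect ∣ ζ 𝟘 ∋ u ] (q ^ m)
  card-ζ𝟘 = ↔-trans (mk↔ₛ′ value (λ u → u , [ ζ-𝟘 u ]) (λ _ → refl) (λ _ → refl)) card-V

module PolarityGraph (F : Field) (p : ℕ) {{_ : NonZero p}} (card-C : Card (Field.Carrier F) (suc p)) (k : ℕ)
  (ζ : Geometry.Subspace F (3 ℕ.+ k) → Geometry.Subspace F (3 ℕ.+ k))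
  (ζ-polarity : Geometry.IsPolarity F (3 ℕ.+ k) ζ)
  (x* : Geometry.Subspace F (3 ℕ.+ k)) (x*-point : Geometry.IsPoint F (3 ℕ.+ k) x*)
  (x*∉ζx* : ¬ Geometry._⊆_ F (3 ℕ.+ k) x* (ζ x*)) where

  m : ℕ
  m = 3 ℕ.+ k

  open Field F
  open FiniteSpace F p card-C m
  open Polarity F p card-C m ζ ζ-polarity
  open IsCommutativeRing isCommutativeRing using (*-identityˡ; *-assoc)
  open Geometry F m using (Vect; Subspace; _∋_; ∋-𝟎; ∋-⊕; ∋-·; _⊆_; _≐_)
  open Geometry.CorGraph F m ζ x*

  v* : Vect
  v* = proj₁ x*-point

  v*≢𝟎 : v* ≢ 𝟎
  v*≢𝟎 = proj₁ (proj₂ x*-point)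

  H : Subspace
  H = ζ ⟨ v* ⟩

  H? : Decidable (H ∋_)
  H? = ζ⟨⟩-decidable v*≢𝟎

  x*≐⟨v*⟩ : x* ≐ ⟨ v* ⟩
  x*≐⟨v*⟩ = isPoint-≐ x* x*-point

  ζx*≐H : ζ x* ≐ H
  ζx*≐H = ζ-cong {x*} {⟨ v* ⟩} x*≐⟨v*⟩

  v*∉H : ¬ H ∋ v*
  v*∉H v*∈H = x*∉ζx* λ w w∈x* →
    proj₂ ζx*≐H w (⟨⟩-⊆ {H} {v*} v*∈H w (proj₁ x*≐⟨v*⟩ w w∈x*))

  π : Vect → Vect
  π u = proj₁ (ζ⟨⟩-complement v*∉H u)

  κ : Vect → Carrier
  κ u = proj₁ (proj₂ (ζ⟨⟩-complement v*∉H u))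

  π∈H : ∀ u → H ∋ π u
  π∈H u = proj₁ (proj₂ (proj₂ (ζ⟨⟩-complement v*∉H u)))

  π-κ : ∀ u → u ≡ π u ⊕ κ u · v*
  π-κ u = proj₂ (proj₂ (proj₂ (ζ⟨⟩-complement v*∉H u)))

  π-κ-unique : ∀ {u h c} → H ∋ h → u ≡ h ⊕ c · v* → π u ≡ h × κ u ≡ c
  π-κ-unique {u} h∈H u≡h+cv* = swap (⊕·-injective H (π∈H u) h∈H v*∉H (trans (sym (π-κ u)) u≡h+cv*))

  π-v* : π v* ≡ 𝟎
  π-v* = proj₁ (π-κ-unique (∋-𝟎 H) (sym (trans (⊕-identityˡ (1# · v*)) (·-identityˡ v*))))

  πκ-· : ∀ c u → π (c · u) ≡ c · π u × κ (c · u) ≡ c * κ u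
  πκ-· c u = π-κ-unique (∋-· H c (π∈H u)) (begin
    c · u                          ≡⟨ cong (c ·_) (π-κ u) ⟩
    c · (π u ⊕ κ u · v*)           ≡⟨ ·-distribˡ c (π u) _ ⟩
    c · π u ⊕ c · κ u · v*         ≡⟨ cong (c · π u ⊕_) (·-assoc c (κ u) v*) ⟩
    c · π u ⊕ (c * κ u) · v*       ∎)
    where open ≡-Reasoning

  π-⊕ : ∀ u w → π (u ⊕ w) ≡ π u ⊕ π w
  π-⊕ u w = proj₁ (π-κ-unique (∋-⊕ H (π∈H u) (π∈H w)) (begin
    u ⊕ w                                    ≡⟨ cong₂ _⊕_ (π-κ u) (π-κ w) ⟩
    π u ⊕ κ u · v* ⊕ (π w ⊕ κ w · v*)        ≡⟨ ⊕-interchange (π u) _ (π w) _ ⟩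
    π u ⊕ π w ⊕ (κ u · v* ⊕ κ w · v*)        ≡⟨ cong (π u ⊕ π w ⊕_) (sym (·-distribʳ (κ u) (κ w) v*)) ⟩
    π u ⊕ π w ⊕ (κ u + κ w) · v*             ∎))
    where open ≡-Reasoning

  π≡𝟎⇒∈⟨v*⟩ : ∀ {u} → π u ≡ 𝟎 → u ≡ κ u · v*
  π≡𝟎⇒∈⟨v*⟩ {u} π≡𝟎 = trans (π-κ u) (trans (cong (_⊕ κ u · v*) π≡𝟎) (⊕-identityˡ _))

  point : Vertex → Subspace
  point z = proj₁ (proj₁ z)

  rep : Vertex → Vect
  rep z = proj₁ (proj₂ (proj₁ z))

  rep≢𝟎 : ∀ z → rep z ≢ 𝟎
  rep≢𝟎 z = proj₁ (proj₂ (proj₂ (proj₁ z)))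

  point≐⟨rep⟩ : ∀ z → point z ≐ ⟨ rep z ⟩
  point≐⟨rep⟩ z = isPoint-≐ (point z) (proj₂ (proj₁ z))

  rep∈point : ∀ z → point z ∋ rep z
  rep∈point z = proj₂ (point≐⟨rep⟩ z) (rep z) (⟨⟩-∋ (rep z))

  rep∉H : ∀ z → ¬ H ∋ rep z
  rep∉H z rep∈H = proj₁ (proj₂ z) λ w w∈ →
    proj₂ ζx*≐H w (⟨⟩-⊆ {H} {rep z} rep∈H w (proj₁ (point≐⟨rep⟩ z) w w∈))

  rep∉⟨v*⟩ : ∀ z → ¬ ⟨ v* ⟩ ∋ rep z
  rep∉⟨v*⟩ z rep∈⟨v*⟩ =
    proj₂ (proj₂ z) (≐-trans {point z} {⟨ rep z ⟩} {x*} (point≐⟨rep⟩ z)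
      (≐-trans {⟨ rep z ⟩} {⟨ v* ⟩} {x*} (⟨⟩-≐ (rep≢𝟎 z) rep∈⟨v*⟩) (≐-sym {x*} {⟨ v* ⟩} x*≐⟨v*⟩)))

  v*∉⟨rep⟩ : ∀ x → ¬ ⟨ rep x ⟩ ∋ v*
  v*∉⟨rep⟩ x v*∈⟨x⟩ = rep∉⟨v*⟩ x (⟨⟩-∋-sym v*≢𝟎 v*∈⟨x⟩)

  π-rep≢𝟎 : ∀ z → π (rep z) ≢ 𝟎
  π-rep≢𝟎 z π≡𝟎 = rep∉⟨v*⟩ z (κ (rep z) , π≡𝟎⇒∈⟨v*⟩ π≡𝟎)

  κ-rep≢0 : ∀ z → κ (rep z) ≢ 0#
  κ-rep≢0 z κ≡0 = rep∉H z (subst (H ∋_) (sym rep≡π) (π∈H (rep z)))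
    where
    rep≡π : rep z ≡ π (rep z)
    rep≡π = trans (π-κ (rep z)) (trans (cong (λ c → π (rep z) ⊕ c · v*) κ≡0)
                                       (trans (cong (π (rep z) ⊕_) (·-zeroˡ v*)) (⊕-identityʳ _)))

  vertex : ∀ {v} → ¬ H ∋ v → ¬ ⟨ v* ⟩ ∋ v → Vertex
  vertex {v} v∉H v∉⟨v*⟩ = (⟨ v ⟩ , ⟨⟩-isPoint v≢𝟎) , ⟨v⟩⊈ζx* , ⟨v⟩≉x*
    where
    v≢𝟎 : v ≢ 𝟎
    v≢𝟎 refl = v∉H (∋-𝟎 H)
    ⟨v⟩⊈ζx* : ¬ ⟨ v ⟩ ⊆ ζ x*
    ⟨v⟩⊈ζx* ⟨v⟩⊆ζx* = v∉H (proj₁ ζx*≐H v (⟨v⟩⊆ζx* v (⟨⟩-∋ v)))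
    ⟨v⟩≉x* : ¬ ⟨ v ⟩ ≐ x*
    ⟨v⟩≉x* ⟨v⟩≐x* = v∉⟨v*⟩ (proj₁ x*≐⟨v*⟩ v (proj₁ ⟨v⟩≐x* v (⟨⟩-∋ v)))

  ≈V⇒∈⟨rep⟩ : ∀ {x y} → x ≈V y → ⟨ rep x ⟩ ∋ rep y
  ≈V⇒∈⟨rep⟩ {x} {y} (_ , y⊆x) = proj₁ (point≐⟨rep⟩ x) (rep y) (y⊆x (rep y) (rep∈point y))

  ∈⟨rep⟩⇒≈V : ∀ {x y} → ⟨ rep x ⟩ ∋ rep y → x ≈V y
  ∈⟨rep⟩⇒≈V {x} {y} y∈⟨x⟩ =
    ≐-trans {point x} {⟨ rep x ⟩} {point y} (point≐⟨rep⟩ x)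
      (≐-trans {⟨ rep x ⟩} {⟨ rep y ⟩} {point y} (≐-sym {⟨ rep y ⟩} {⟨ rep x ⟩} (⟨⟩-≐ (rep≢𝟎 y) y∈⟨x⟩))
                                                (≐-sym {point y} {⟨ rep y ⟩} (point≐⟨rep⟩ y)))

  ζ⟨rep⟩? : ∀ x → Decidable (ζ ⟨ rep x ⟩ ∋_)
  ζ⟨rep⟩? x = ζ⟨⟩-decidable (rep≢𝟎 x)

  ζpoint≐ζ⟨rep⟩ : ∀ x → ζ (point x) ≐ ζ ⟨ rep x ⟩
  ζpoint≐ζ⟨rep⟩ x = ζ-cong {point x} {⟨ rep x ⟩} (point≐⟨rep⟩ x)

  adj⇒ζ⟨rep⟩ : ∀ {x z} → Adj x z → ζ ⟨ rep x ⟩ ∋ rep z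
  adj⇒ζ⟨rep⟩ {x} {z} x~z =
    proj₁ (ζpoint≐ζ⟨rep⟩ x) (rep z) (x~z (rep z) (rep∈point z))

  ζ⟨rep⟩⇒adj : ∀ {x z} → ζ ⟨ rep x ⟩ ∋ rep z → Adj x z
  ζ⟨rep⟩⇒adj {x} {z} rep∈ζ w w∈ =
    proj₂ (ζpoint≐ζ⟨rep⟩ x) w (⟨⟩-⊆ {ζ ⟨ rep x ⟩} {rep z} rep∈ζ w (proj₁ (point≐⟨rep⟩ z) w w∈))

  adj-sym : ∀ {x z} → Adj x z → ζ ⟨ rep z ⟩ ∋ rep x
  adj-sym {x} {z} x~z = ζ⟨⟩-sym (adj⇒ζ⟨rep⟩ {x} {z} x~z)

  ζ⟨rep⟩-off-⟨v*⟩ : ∀ x {v} → ζ ⟨ rep x ⟩ ∋ v → ¬ H ∋ v → ¬ ⟨ v* ⟩ ∋ v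
  ζ⟨rep⟩-off-⟨v*⟩ x {v} v∈ζx v∉H v∈⟨v*⟩ = rep∉H x (ζ⟨⟩-sym v*∈ζx)
    where
    v≢𝟎 : v ≢ 𝟎
    v≢𝟎 refl = v∉H (∋-𝟎 H)
    v*∈ζx : ζ ⟨ rep x ⟩ ∋ v*
    v*∈ζx = ⟨⟩-⊆ {ζ ⟨ rep x ⟩} {v} v∈ζx v* (⟨⟩-∋-sym v≢𝟎 v∈⟨v*⟩)

  card-ζ⟨⟩ : ∀ {v} → v ≢ 𝟎 → Card [ u ∈ Vect ∣ ζ ⟨ v ⟩ ∋ u ] (q ^ (2 ℕ.+ k))
  card-ζ⟨⟩ v≢𝟎 =
    refine-cong proj₂ (λ u∈ → ζ-𝟘 _ , u∈) (card-ζ-section (λ u → yes (ζ-𝟘 u)) v≢𝟎 {n = 2 ℕ.+ k} card-ζ𝟘)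

  card-H : Card [ u ∈ Vect ∣ H ∋ u ] (q ^ (2 ℕ.+ k))
  card-H = card-ζ⟨⟩ v*≢𝟎

  card-∖H : ∀ {S : Pred Vect 0ℓ} {n} → Card [ u ∈ Vect ∣ S u ] (q ^ suc n) →
            Card [ u ∈ Vect ∣ S u × H ∋ u ] (q ^ n) → Card [ u ∈ Vect ∣ S u × ¬ H ∋ u ] (p ℕ.* q ^ n)
  card-∖H {n = n} card-S card-S∩H =
    subst (Card _) (ℕₚ.m+n∸m≡n (q ^ n) (p ℕ.* q ^ n)) (card-∖ H? card-S card-S∩H)

  _≈Σ_ : ∀ {P : Vertex → Set} → Σ Vertex P → Σ Vertex P → Set
  a ≈Σ b = proj₁ a ≈V proj₁ b

  -- Vertices z with P z correspond to the normalised vectors v ∉ H with Q v, via z ↦ normalise (rep z).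
  module _ (P : Vertex → Set) {Q : Pred Vect 0ℓ} (Q? : Decidable Q)
           (Q-scale : ∀ {c v} → c ≢ 0# → Q v → Q (c · v))
           (Q-off-⟨v*⟩ : ∀ {v} → Q v → ¬ H ∋ v → ¬ ⟨ v* ⟩ ∋ v)
           (P⇒Q : ∀ z → P z → Q (rep z))
           (Q⇒P : ∀ {v} (v∉H : ¬ H ∋ v) (v∉⟨v*⟩ : ¬ ⟨ v* ⟩ ∋ v) → Q v → P (vertex v∉H v∉⟨v*⟩)) where

    private
      D : Pred Vect 0ℓ
      D v = Q v × ¬ H ∋ v

      toVertex : [ v ∈ Vect ∣ Normalised v × D v ] → Σ Vertex P
      toVertex (v , [ nrm-D ]) = vertex v∉H (Q-off-⟨v*⟩ Qv v∉H) , Q⇒P v∉H (Q-off-⟨v*⟩ Qv v∉H) Qv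
        where
        Qv = recompute (Q? v) (proj₁ (proj₂ nrm-D))
        v∉H = ¬-recompute (proj₂ (proj₂ nrm-D))

      toVertex-injective : ∀ a b → toVertex a ≈Σ toVertex b → a ≡ b
      toVertex-injective (u , [ nrm-Du ]) (v , [ nrm-Dv ]) ⟨u⟩≐⟨v⟩ =
        value-injective (normalised-unique (recompute (lead v ≟ 1#) (proj₁ nrm-Dv))
                                           (recompute (lead u ≟ 1#) (proj₁ nrm-Du))
                                           (proj₂ (proj₁ ⟨u⟩≐⟨v⟩ u (⟨⟩-∋ u))))

      toVertex-surjective : ∀ z → ∃[ a ] toVertex a ≈Σ z
      toVertex-surjective (z , Pz) =
        (normalise (rep z) , [ normalise-normalised (rep≢𝟎 z) , Q-scale l⁻¹≢0 (P⇒Q z Pz) , ∉-· H l⁻¹≢0 (rep∉H z) ])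
        , ≐-trans {⟨ normalise (rep z) ⟩} {⟨ rep z ⟩} {point z}
                  (⟨⟩-· l⁻¹≢0) (≐-sym {point z} {⟨ rep z ⟩} (point≐⟨rep⟩ z))
        where
        l⁻¹≢0 = ⁻¹-nonzero (lead-nonzero (rep≢𝟎 z))

    hasSize-vertices : ∀ {n} → Card [ v ∈ Vect ∣ D v ] (p ℕ.* n) → HasSize (Σ Vertex P) _≈Σ_ n
    hasSize-vertices card-D = toVertex ∘ from N , injective , surjective
      where
      D-nonzero : ∀ {v} → D v → v ≢ 𝟎
      D-nonzero (_ , v∉H) refl = v∉H (∋-𝟎 H)
      N = card-normalised-exact (λ v → Q? v ×-dec ¬? (H? v)) D-nonzero
            (λ c≢0 (Qv , v∉H) → Q-scale c≢0 Qv , ∉-· H c≢0 v∉H) card-D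

      injective : ∀ i j → toVertex (from N i) ≈Σ toVertex (from N j) → i ≡ j
      injective i j = from-injective N ∘ toVertex-injective (from N i) (from N j)

      surjective : ∀ z → ∃[ i ] toVertex (from N i) ≈Σ z
      surjective z = let a , a≈z = toVertex-surjective z
                     in to N a , subst (λ b → toVertex b ≈Σ z) (sym (strictlyInverseʳ N a)) a≈z

  Direction : Pred Vect 0ℓ
  Direction h = Normalised h × H ∋ h × h ≢ 𝟎

  Direction? : Decidable Direction
  Direction? h = (lead h ≟ 1#) ×-dec H? h ×-dec ¬? (h ≟ᵥ 𝟎)

  key : Vertex → Vect
  key z = normalise (π (rep z))

  key-direction : ∀ z → Direction (key z)
  key-direction z = key-normalised , ∋-· H _ (π∈H (rep z)) , normalised⇒nonzero key-normalised
    where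
    key-normalised = normalise-normalised (π-rep≢𝟎 z)

  π-proportional⇒key≡ : ∀ {x y c} → π (rep y) ≡ c · π (rep x) → key y ≡ key x
  π-proportional⇒key≡ {x} {y} {c} πy≡cπx = trans (cong normalise πy≡cπx) (normalise-· c≢0 (π-rep≢𝟎 x))
    where
    c≢0 : c ≢ 0#
    c≢0 c≡0 = π-rep≢𝟎 y (trans πy≡cπx (trans (cong (_· π (rep x)) c≡0) (·-zeroˡ _)))

  key≡⇒π-proportional : ∀ {x y} → key x ≡ key y → ∃[ s ] s ≢ 0# × π (rep y) ≡ s · π (rep x)
  key≡⇒π-proportional {x} {y} kx≡ky =
    s , *-nonzero (lead-nonzero (π-rep≢𝟎 y)) (⁻¹-nonzero (lead-nonzero (π-rep≢𝟎 x))) , (begin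
    π (rep y)                              ≡⟨ sym (lead·normalise (π-rep≢𝟎 y)) ⟩
    lead (π (rep y)) · key y               ≡⟨ cong (lead (π (rep y)) ·_) (sym kx≡ky) ⟩
    lead (π (rep y)) · lead (π (rep x)) ⁻¹ · π (rep x) ≡⟨ ·-assoc _ _ (π (rep x)) ⟩
    s · π (rep x)                          ∎)
    where
    open ≡-Reasoning
    s = lead (π (rep y)) * lead (π (rep x)) ⁻¹

  coplanar⇒key≡ : ∀ {x y a d} → rep y ≡ a · v* ⊕ d · rep x → key y ≡ key x
  coplanar⇒key≡ {x} {y} {a} {d} y≡av*+dx = π-proportional⇒key≡ {x} {y} (begin
    π (rep y)                    ≡⟨ cong π y≡av*+dx ⟩
    π (a · v* ⊕ d · rep x)       ≡⟨ π-⊕ (a · v*) (d · rep x) ⟩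
    π (a · v*) ⊕ π (d · rep x)   ≡⟨ cong₂ _⊕_ (proj₁ (πκ-· a v*)) (proj₁ (πκ-· d (rep x))) ⟩
    a · π v* ⊕ d · π (rep x)     ≡⟨ cong (λ u → a · u ⊕ d · π (rep x)) π-v* ⟩
    a · 𝟎 ⊕ d · π (rep x)        ≡⟨ cong (_⊕ d · π (rep x)) (·-zeroʳ a) ⟩
    𝟎 ⊕ d · π (rep x)            ≡⟨ ⊕-identityˡ _ ⟩
    d · π (rep x)                ∎)
    where open ≡-Reasoning

  M : ℕ
  M = (q ^ (2 ℕ.+ k) ∸ 1) / p

  card-directions : Card [ h ∈ Vect ∣ Direction h ] M
  card-directions =
    let n , card-N , p*n≡ = card-normalised H∖𝟎? proj₂ (λ c≢0 (h∈H , h≢𝟎) → ∋-· H _ h∈H , ∉-· 𝟘 c≢0 h≢𝟎)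
                                            (card-∖ (_≟ᵥ 𝟎) card-H card-H∩𝟘)
    in subst (Card _) (trans (sym (m*n/n≡m n p)) (cong (_/ p) (trans (ℕₚ.*-comm n p) p*n≡))) card-N
    where
    H∖𝟎? : Decidable (λ h → H ∋ h × h ≢ 𝟎)
    H∖𝟎? h = H? h ×-dec ¬? (h ≟ᵥ 𝟎)
    card-H∩𝟘 : Card [ h ∈ Vect ∣ H ∋ h × h ≡ 𝟎 ] 1
    card-H∩𝟘 = mk↔ₛ′ (λ _ → zero) (λ _ → 𝟎 , [ ∋-𝟎 H , refl ]) (λ { zero → refl ; (suc ()) })
                     (λ (h , [ h∈ ]) → value-injective (sym (recompute (h ≟ᵥ 𝟎) (proj₂ h∈))))

  cls : Vertex → Fin M
  cls z = to card-directions (key z , [ key-direction z ])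

  cls≡⇒key≡ : ∀ x y → cls x ≡ cls y → key x ≡ key y
  cls≡⇒key≡ x y = cong value ∘ to-injective card-directions

  key≡⇒cls≡ : ∀ x y → key x ≡ key y → cls x ≡ cls y
  key≡⇒cls≡ x y = cong (to card-directions) ∘ value-injective

  module Class {h : Vect} (h-direction : Direction h) where

    private
      h-nrm = proj₁ h-direction
      h∈H   = proj₁ (proj₂ h-direction)
      h≢𝟎   = proj₂ (proj₂ h-direction)

    line : Carrier → Vect
    line a = h ⊕ a · v*

    π-line : ∀ a → π (line a) ≡ h
    π-line a = proj₁ (π-κ-unique h∈H refl)

    κ-line : ∀ a → κ (line a) ≡ a
    κ-line a = proj₂ (π-κ-unique h∈H refl)

    line∉H : ∀ {a} → a ≢ 0# → ¬ H ∋ line a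
    line∉H {a} a≢0 line∈H = a≢0 (trans (sym (κ-line a))
      (proj₂ (π-κ-unique line∈H (sym (trans (cong (line a ⊕_) (·-zeroˡ v*)) (⊕-identityʳ (line a)))))))

    line∉⟨v*⟩ : ∀ a → ¬ ⟨ v* ⟩ ∋ line a
    line∉⟨v*⟩ a (c , line≡cv*) = h≢𝟎 (begin
      h               ≡⟨ sym (π-line a) ⟩
      π (line a)      ≡⟨ cong π line≡cv* ⟩
      π (c · v*)      ≡⟨ proj₁ (πκ-· c v*) ⟩
      c · π v*        ≡⟨ cong (c ·_) π-v* ⟩
      c · 𝟎           ≡⟨ ·-zeroʳ c ⟩
      𝟎               ∎)
      where open ≡-Reasoning

    member : [ a ∈ Carrier ∣ a ≢ 0# ] → Vertex
    member (a , [ a≢0 ]) = vertex (line∉H (¬-recompute a≢0)) (line∉⟨v*⟩ a)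

    key-member : ∀ a → key (member a) ≡ h
    key-member (a , _) = trans (cong normalise (π-line a)) (normalise-id h-nrm)

    member-injective : ∀ a b → member a ≈V member b → a ≡ b
    member-injective (a , _) (b , _) (_ , ⟨lb⟩⊆⟨la⟩) = value-injective (begin
      a                ≡⟨ sym (*-identityˡ a) ⟩
      1# * a           ≡⟨ cong (_* a) (sym t≡1) ⟩
      t * a            ≡⟨ cong (t *_) (sym (κ-line a)) ⟩
      t * κ (line a)   ≡⟨ sym (proj₂ (πκ-· t (line a))) ⟩
      κ (t · line a)   ≡⟨ cong κ (sym lb≡t·la) ⟩
      κ (line b)       ≡⟨ κ-line b ⟩
      b                ∎)
      where
      open ≡-Reasoning
      t = proj₁ (⟨lb⟩⊆⟨la⟩ (line b) (⟨⟩-∋ (line b)))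
      lb≡t·la = proj₂ (⟨lb⟩⊆⟨la⟩ (line b) (⟨⟩-∋ (line b)))
      h≡t·h : h ≡ t · h
      h≡t·h = begin
        h                ≡⟨ sym (π-line b) ⟩
        π (line b)       ≡⟨ cong π lb≡t·la ⟩
        π (t · line a)   ≡⟨ proj₁ (πκ-· t (line a)) ⟩
        t · π (line a)   ≡⟨ cong (t ·_) (π-line a) ⟩
        t · h            ∎
      t≡1 : t ≡ 1#
      t≡1 = normalised-scalar h-nrm h-nrm h≡t·h

    member-surjective : ∀ y → key y ≡ h → ∃[ a ] member a ≈V y
    member-surjective y ky≡h =
      (a , [ a≢0 ]) , ∈⟨rep⟩⇒≈V {member (a , [ a≢0 ])} {y} (s , rep≡s·line)
      where
      open ≡-Reasoning
      s = lead (π (rep y))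
      s≢0 = lead-nonzero (π-rep≢𝟎 y)
      a = s ⁻¹ * κ (rep y)
      a≢0 = *-nonzero (⁻¹-nonzero s≢0) (κ-rep≢0 y)
      rep≡s·line : rep y ≡ s · line a
      rep≡s·line = begin
        rep y                               ≡⟨ π-κ (rep y) ⟩
        π (rep y) ⊕ κ (rep y) · v*          ≡⟨ cong (_⊕ κ (rep y) · v*) (sym (lead·normalise (π-rep≢𝟎 y))) ⟩
        s · key y ⊕ κ (rep y) · v*          ≡⟨ cong (λ x → s · x ⊕ κ (rep y) · v*) ky≡h ⟩
        s · h ⊕ κ (rep y) · v*              ≡⟨ cong (λ c → s · h ⊕ c · v*) (sym s*a≡κ) ⟩
        s · h ⊕ (s * a) · v*                ≡⟨ cong (s · h ⊕_) (sym (·-assoc s a v*)) ⟩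
        s · h ⊕ s · a · v*                  ≡⟨ sym (·-distribˡ s h (a · v*)) ⟩
        s · line a                          ∎
        where
        s*a≡κ : s * a ≡ κ (rep y)
        s*a≡κ = trans (sym (*-assoc s (s ⁻¹) _)) (trans (cong (_* κ (rep y)) (⁻¹-inverseʳ s≢0)) (*-identityˡ _))

  direction-of : (d : [ h ∈ Vect ∣ Direction h ]) → Direction (value d)
  direction-of (h , [ dir ]) = recompute (Direction? h) dir

  cls-size : ∀ c → HasSize (Σ Vertex (λ y → cls y ≡ c)) _≈Σ_ p
  cls-size c = (λ i → member (from card-nonzero i) , member-cls (from card-nonzero i)) , injective , surjective
    where
    d = from card-directions c
    open Class (direction-of d)

    member-cls : ∀ a → cls (member a) ≡ c
    member-cls a =
      trans (cong (to card-directions) (value-injective {w = d} (key-member a))) (strictlyInverseˡ card-directions c)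

    injective : ∀ i j → member (from card-nonzero i) ≈V member (from card-nonzero j) → i ≡ j
    injective i j = from-injective card-nonzero ∘ member-injective (from card-nonzero i) (from card-nonzero j)

    surjective : ∀ ((y , _) : Σ Vertex (λ y → cls y ≡ c)) → ∃[ i ] member (from card-nonzero i) ≈V y
    surjective (y , cls-y≡c) =
      let a , a≈y = member-surjective y ky≡h
      in to card-nonzero a , subst (λ b → member b ≈V y) (sym (strictlyInverseʳ card-nonzero a)) a≈y
      where
      ky≡h : key y ≡ value d
      ky≡h = cong value (trans (sym (strictlyInverseʳ card-directions (key y , [ key-direction y ])))
                               (cong (from card-directions) cls-y≡c))

  card-vertex-vectors : Card [ v ∈ Vect ∣ ¬ ⟨ v* ⟩ ∋ v × ¬ H ∋ v ] (p ℕ.* (q ^ (2 ℕ.+ k) ∸ 1))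
  card-vertex-vectors =
    refine-cong (λ ((_ , v∉H) , v∉⟨v*⟩) → v∉⟨v*⟩ , v∉H) (λ (v∉⟨v*⟩ , v∉H) → (ζ-𝟘 _ , v∉H) , v∉⟨v*⟩)
      (subst (Card _) p*qⁿ∸p≡p*[qⁿ∸1] (card-∖ (⟨⟩? v*) card-off-H card-⟨v*⟩-off-H))
    where
    card-off-H : Card [ u ∈ Vect ∣ ζ 𝟘 ∋ u × ¬ H ∋ u ] (p ℕ.* q ^ (2 ℕ.+ k))
    card-off-H = card-∖H {n = 2 ℕ.+ k} card-ζ𝟘 (card-ζ-section (λ u → yes (ζ-𝟘 u)) v*≢𝟎 {n = 2 ℕ.+ k} card-ζ𝟘)
    card-⟨v*⟩-off-H : Card [ u ∈ Vect ∣ (ζ 𝟘 ∋ u × ¬ H ∋ u) × ⟨ v* ⟩ ∋ u ] p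
    card-⟨v*⟩-off-H = refine-cong
      (λ {u} (u∈⟨v*⟩ , u≢𝟎) → (ζ-𝟘 u , λ u∈H → v*∉H (⟨⟩-⊆ {H} {u} u∈H v* (⟨⟩-∋-sym u≢𝟎 u∈⟨v*⟩))) , u∈⟨v*⟩)
      (λ ((_ , u∉H) , u∈⟨v*⟩) → u∈⟨v*⟩ , λ { refl → u∉H (∋-𝟎 H) })
      (card-⟨⟩∖𝟎 v*≢𝟎)
    p*qⁿ∸p≡p*[qⁿ∸1] : p ℕ.* q ^ (2 ℕ.+ k) ∸ p ≡ p ℕ.* (q ^ (2 ℕ.+ k) ∸ 1)
    p*qⁿ∸p≡p*[qⁿ∸1] =
      sym (trans (ℕₚ.*-distribˡ-∸ p (q ^ (2 ℕ.+ k)) 1) (cong (p ℕ.* q ^ (2 ℕ.+ k) ∸_) (ℕₚ.*-identityʳ p)))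

  vertices : HasSize Vertex _≈V_ (q ^ (2 ℕ.+ k) ∸ 1)
  vertices =
    let f , f-injective , f-surjective = hasSize-vertices (λ _ → ⊤) (¬? ∘ ⟨⟩? v*)
          (λ c≢0 → ∉-· ⟨ v* ⟩ c≢0) (λ v∉⟨v*⟩ _ → v∉⟨v*⟩) (λ z _ → rep∉⟨v*⟩ z) (λ _ _ _ → tt) card-vertex-vectors
    in proj₁ ∘ f , f-injective , λ z → f-surjective (z , tt)

  regular : ∀ x → HasSize (Σ Vertex (Adj x)) _≈Σ_ (q ^ (1 ℕ.+ k))
  regular x = hasSize-vertices (Adj x) (ζ⟨rep⟩? x) (λ c≢0 → ∋-· (ζ ⟨ rep x ⟩) _) (ζ⟨rep⟩-off-⟨v*⟩ x)
    (λ z → adj⇒ζ⟨rep⟩ {x} {z}) (λ v∉H v∉⟨v*⟩ → ζ⟨rep⟩⇒adj {x} {vertex v∉H v∉⟨v*⟩})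
    (card-∖H {n = 1 ℕ.+ k} (card-ζ⟨⟩ (rep≢𝟎 x))
                           (card-ζ-section (ζ⟨rep⟩? x) (v*∉⟨rep⟩ x) {n = 1 ℕ.+ k} (card-ζ⟨⟩ (rep≢𝟎 x))))

  no-common-neighbour : ∀ x y → ¬ x ≈V y → cls x ≡ cls y → ∀ z → Adj x z → Adj y z → ⊥
  no-common-neighbour x y x≉y cx≡cy z x~z y~z = contradict (κ d ≟ 0#)
    where
    s = proj₁ (key≡⇒π-proportional {x} {y} (cls≡⇒key≡ x y cx≡cy))
    πy≡sπx = proj₂ (proj₂ (key≡⇒π-proportional {x} {y} (cls≡⇒key≡ x y cx≡cy)))
    d = rep y ⊕ ⊖ (s · rep x)
    Z = ζ ⟨ rep z ⟩
    d∈Z : Z ∋ d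
    d∈Z = ∋-⊕ Z (adj-sym {y} {z} y~z) (∋-⊖ Z (∋-· Z s (adj-sym {x} {z} x~z)))
    πd≡𝟎 : π d ≡ 𝟎
    πd≡𝟎 = begin
      π d                                   ≡⟨ π-⊕ (rep y) _ ⟩
      π (rep y) ⊕ π (⊖ (s · rep x))         ≡⟨ cong₂ _⊕_ πy≡sπx (proj₁ (πκ-· (- 1#) (s · rep x))) ⟩
      s · π (rep x) ⊕ ⊖ π (s · rep x)       ≡⟨ cong (λ u → s · π (rep x) ⊕ ⊖ u) (proj₁ (πκ-· s (rep x))) ⟩
      s · π (rep x) ⊕ ⊖ (s · π (rep x))     ≡⟨ ⊖-inverseʳ _ ⟩
      𝟎                                     ∎
      where open ≡-Reasoning
    d≡κd·v* : d ≡ κ d · v*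
    d≡κd·v* = π≡𝟎⇒∈⟨v*⟩ πd≡𝟎
    contradict : Dec (κ d ≡ 0#) → ⊥
    contradict (yes κd≡0) = x≉y (∈⟨rep⟩⇒≈V {x} {y} (s , ⊖≡𝟎⇒≡ (rep y) (s · rep x) d≡𝟎))
      where
      d≡𝟎 : d ≡ 𝟎
      d≡𝟎 = trans d≡κd·v* (trans (cong (_· v*) κd≡0) (·-zeroˡ v*))
    contradict (no κd≢0) = rep∉H z (ζ⟨⟩-sym v*∈Z)
      where
      v*∈Z : Z ∋ v*
      v*∈Z = subst (Z ∋_) (·-⁻¹-cancel κd≢0 v*) (∋-· Z (κ d ⁻¹) (subst (Z ∋_) d≡κd·v* d∈Z))

  diff-cls⇒independent : ∀ x y → cls x ≢ cls y → ¬ (⟨ v* ⟩ +ₛ ⟨ rep x ⟩) ∋ rep y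
  diff-cls⇒independent x y cx≢cy (s , t , (a , s≡av*) , (d , t≡dx) , y≡s+t) =
    cx≢cy (sym (key≡⇒cls≡ y x (coplanar⇒key≡ {x} {y} (trans y≡s+t (cong₂ _⊕_ s≡av* t≡dx)))))

  common-neighbours : ∀ x y → cls x ≢ cls y → HasSize (Σ Vertex (λ z → Adj x z × Adj y z)) _≈Σ_ (q ^ k)
  common-neighbours x y cx≢cy = hasSize-vertices (λ z → Adj x z × Adj y z) (λ v → ζ⟨rep⟩? x v ×-dec ζ⟨rep⟩? y v)
    (λ c≢0 (v∈ζx , v∈ζy) → ∋-· (ζ ⟨ rep x ⟩) _ v∈ζx , ∋-· (ζ ⟨ rep y ⟩) _ v∈ζy)
    (λ (v∈ζx , _) → ζ⟨rep⟩-off-⟨v*⟩ x v∈ζx)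
    (λ z (x~z , y~z) → adj⇒ζ⟨rep⟩ {x} {z} x~z , adj⇒ζ⟨rep⟩ {y} {z} y~z)
    (λ v∉H v∉⟨v*⟩ (v∈ζx , v∈ζy) →
       ζ⟨rep⟩⇒adj {x} {vertex v∉H v∉⟨v*⟩} v∈ζx , ζ⟨rep⟩⇒adj {y} {vertex v∉H v∉⟨v*⟩} v∈ζy)
    (card-∖H {n = k} card-ζx∩ζy card-ζx∩ζy∩H)
    where
    A = ⟨ v* ⟩ +ₛ ⟨ rep x ⟩
    y∉A = diff-cls⇒independent x y cx≢cy
    ζA⇒H∩ζx : ∀ {u} → ζ A ∋ u → H ∋ u × ζ ⟨ rep x ⟩ ∋ u
    ζA⇒H∩ζx {u} u∈ζA = ζ-antitone {⟨ v* ⟩} {A} (+ₛ-⊆ˡ {⟨ v* ⟩} {⟨ rep x ⟩}) u u∈ζA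
                     , ζ-antitone {⟨ rep x ⟩} {A} (+ₛ-⊆ʳ {⟨ v* ⟩} {⟨ rep x ⟩}) u u∈ζA
    H∩ζx⇒ζA : ∀ {u} → H ∋ u × ζ ⟨ rep x ⟩ ∋ u → ζ A ∋ u
    H∩ζx⇒ζA {u} = ζ-+ₛ {⟨ v* ⟩} {⟨ rep x ⟩} u
    ζA? : Decidable (ζ A ∋_)
    ζA? u = map′ H∩ζx⇒ζA ζA⇒H∩ζx (H? u ×-dec ζ⟨rep⟩? x u)
    card-ζA : Card [ u ∈ Vect ∣ ζ A ∋ u ] (q ^ (1 ℕ.+ k))
    card-ζA = refine-cong H∩ζx⇒ζA ζA⇒H∩ζx (card-ζ-section H? (rep∉⟨v*⟩ x) {n = 1 ℕ.+ k} card-H)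
    card-ζx∩ζy : Card [ u ∈ Vect ∣ ζ ⟨ rep x ⟩ ∋ u × ζ ⟨ rep y ⟩ ∋ u ] (q ^ (1 ℕ.+ k))
    card-ζx∩ζy =
      card-ζ-section (ζ⟨rep⟩? x) (y∉A ∘ +ₛ-⊆ʳ {⟨ v* ⟩} {⟨ rep x ⟩} (rep y)) {n = 1 ℕ.+ k} (card-ζ⟨⟩ (rep≢𝟎 x))
    card-ζx∩ζy∩H : Card [ u ∈ Vect ∣ (ζ ⟨ rep x ⟩ ∋ u × ζ ⟨ rep y ⟩ ∋ u) × H ∋ u ] (q ^ k)
    card-ζx∩ζy∩H = refine-cong (λ (u∈ζA , u∈ζy) → let u∈H , u∈ζx = ζA⇒H∩ζx u∈ζA in (u∈ζx , u∈ζy) , u∈H)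
                               (λ ((u∈ζx , u∈ζy) , u∈H) → H∩ζx⇒ζA (u∈H , u∈ζx) , u∈ζy)
                               (card-ζ-section ζA? y∉A {n = k} card-ζA)

  cls-resp : ∀ x y → x ≈V y → cls x ≡ cls y
  cls-resp x y x≈y =
    let c , y≡cx = ≈V⇒∈⟨rep⟩ {x} {y} x≈y
    in sym (key≡⇒cls≡ y x (π-proportional⇒key≡ {x} {y} (trans (cong π y≡cx) (proj₁ (πκ-· c (rep x))))))

  same-cls : ∀ x y → ¬ x ≈V y → cls x ≡ cls y → HasSize (Σ Vertex (λ z → Adj x z × Adj y z)) _≈Σ_ 0
  same-cls x y x≉y cx≡cy = (λ ()) , (λ ()) , λ (z , x~z , y~z) → ⊥-elim (no-common-neighbour x y x≉y cx≡cy z x~z y~z)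

  isLDDG : IsLDDG Vertex _≈V_ Adj (q ^ (2 ℕ.+ k) ∸ 1) (q ^ (1 ℕ.+ k)) 0 (q ^ k) M p
  isLDDG = record
    { vertices = vertices
    ; regular  = regular
    ; cls      = cls
    ; cls-resp = cls-resp
    ; cls-size = cls-size
    ; same-cls = same-cls
    ; diff-cls = common-neighbours
    }

corollary5p6 : (F : Field) (q m : ℕ) → 3 ≤ m → 3 ≤ q →
    HasSize (Field.Carrier F) _≡_ q →
    (ζ : Geometry.Subspace F m → Geometry.Subspace F m) → Geometry.IsPolarity F m ζ →
    (x* : Geometry.Subspace F m) → Geometry.IsPoint F m x* →
    ¬ (Geometry._⊆_ F m x* (ζ x*)) →
    IsLDDG (Geometry.CorGraph.Vertex F m ζ x*) (Geometry.CorGraph._≈V_ F m ζ x*)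
           (Geometry.CorGraph.Adj F m ζ x*)
           (q ^ (m ∸ 1) ∸ 1) (q ^ (m ∸ 2)) 0 (q ^ (m ∸ 3))
           ((q ^ (m ∸ 1) ∸ 1) div (q ∸ 1)) (q ∸ 1)
-- The hypothesis 3 ≤ q only serves to write q = suc p with p ≠ 0, which holds in every field.
corollary5p6 F (suc (suc (suc r))) (suc (suc (suc k))) (s≤s (s≤s (s≤s _))) (s≤s (s≤s (s≤s _)))
             card-F ζ ζ-polarity x* x*-point x*∉ζx* =
  PolarityGraph.isLDDG F (suc (suc r)) (hasSize⇒card card-F) k ζ ζ-polarity x* x*-point x*∉ζx*
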